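{- Let $D$ be the derivation of $\mathbb{Q}[X,Y,Z]$ with $D(X)=YZ$, $D(Y)=XZ$, $D(Z)=XY$. Define $(XD)^0(Y)=Y$, $(XD)^{n+1}(Y)=X\,D\big((XD)^n(Y)\big)$, and for $n\ge1$ define integers $b_{n,i,j}$ by $$(XD)^{2n}(Y)=\sum_{i,j\ge0}b_{2n,i,j}X^{2i+2}Y^{4n-1-2i-2j}Z^{2j},\qquad (XD)^{2n+1}(Y)=\sum_{i,j\ge0}b_{2n+1,i,j}X^{2i+2}Y^{4n-2i-2j}Z^{2j+1}$$ (the second expansion also for $n=0$). Then for $n\ge1$: (i) $\sum_{i,j\ge0}b_{n,i,j}=(2n-1)!!$; (ii) $\sum_{j\ge0}b_{n,i,j}=N(n,i+1)$; (iii) $\sum_{i\ge0}b_{n,i,\lfloor n/2\rfloor}x^i=P_n(x)$ and $\sum_{i\ge0}b_{n,i,\lfloor n/2\rfloor-i}x^i=\frac12P_{n+1}(x)$.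
   Context: $\mathfrak S_n$ is the symmetric group on $[n]$. An interior peak of $\pi\in\mathfrak S_n$ is an index $i\in\{2,\dots,n-1\}$ with $\pi(i-1)<\pi(i)>\pi(i+1)$; $P_{n,k}$ is the number of $\pi\in\mathfrak S_n$ with $k$ interior peaks and $P_n(x)=\sum_kP_{n,k}x^k$. $N(n,k)$ is the number of perfect matchings of $[2n]$ (partitions of $[2n]$ into blocks of size 2) in which exactly $k$ blocks have odd smaller element. -}

module Defs where

open import Data.Nat using (ℕ; zero; suc; _+_; _*_; _∸_; _<ᵇ_; _≤ᵇ_; _≡ᵇ_; _/_; _%_)
open import Data.Bool using (Bool; true; false; if_then_else_; _∧_; not)
open import Data.Product using (_×_; _,_)
open import Data.List using (List; []; _∷_; map; concatMap; _++_; length)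
open import Data.Fin using (Fin; toℕ)
open import Data.Fin.Base using () renaming (zero to fz; suc to fs)
open import Data.Vec using (Vec; lookup; toList) renaming ([] to []ᵥ; _∷_ to _∷ᵥ_)
open import Data.List using (allFin) public

-- Polynomials in ℕ[X,Y,Z] ⊆ ℚ[X,Y,Z] as finite formal sums of terms
-- c · X^a Y^b Z^c, represented by lists of (coefficient, a, b, c).
-- (Repeated monomials are allowed; the coefficient of a monomial is
-- the sum of the coefficients of all matching terms.)

Term : Set
Term = ℕ × ℕ × ℕ × ℕ

Poly : Set
Poly = List Term

coeff : Poly → ℕ → ℕ → ℕ → ℕ
coeff [] a b c = 0
coeff ((k , a' , b' , c') ∷ p) a b c =
  (if (a' ≡ᵇ a) ∧ (b' ≡ᵇ b) ∧ (c' ≡ᵇ c) then k else 0) + coeff p a b c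

-- The derivation D with D X = YZ, D Y = XZ, D Z = XY, on a monomial
-- (Leibniz rule): D(X^a Y^b Z^c) = a X^{a-1} Y^{b+1} Z^{c+1}
--   + b X^{a+1} Y^{b-1} Z^{c+1} + c X^{a+1} Y^{b+1} Z^{c-1}.
-- (When the exponent is 0 the corresponding coefficient is 0.)
DTerm : Term → Poly
DTerm (k , a , b , c) =
  (k * a , a ∸ 1 , suc b , suc c) ∷
  (k * b , suc a , b ∸ 1 , suc c) ∷
  (k * c , suc a , suc b , c ∸ 1) ∷ []

D : Poly → Poly
D = concatMap DTerm

mulX : Poly → Poly
mulX = map (λ { (k , a , b , c) → (k , suc a , b , c) })

XDpow : ℕ → Poly
XDpow zero = (1 , 0 , 1 , 0) ∷ []
XDpow (suc n) = mulX (D (XDpow n))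

-- b_{n,i,j}: for n = 2m, coefficient of X^{2i+2} Y^{4m-1-2i-2j} Z^{2j};
-- for n = 2m+1, coefficient of X^{2i+2} Y^{4m-2i-2j} Z^{2j+1};
-- and 0 when the Y-exponent would be negative (no such term).
-- Uniformly: Z-exponent e = 2j + (n mod 2), Y-exponent = 2n+1-(2i+2)-e.
b : ℕ → ℕ → ℕ → ℕ
b n i j =
  let e = 2 * j + n % 2 in
  if (2 * i + 2 + e) ≤ᵇ (2 * n + 1)
    then coeff (XDpow n) (2 * i + 2) ((2 * n + 1) ∸ (2 * i + 2 + e)) e
    else 0

sumTo : ℕ → (ℕ → ℕ) → ℕ
sumTo zero f = 0
sumTo (suc n) f = sumTo n f + f n

count : {A : Set} → (A → Bool) → List A → ℕ
count p [] = 0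
count p (x ∷ xs) = (if p x then 1 else 0) + count p xs

oddDoubleFact : ℕ → ℕ
oddDoubleFact zero = 1
oddDoubleFact (suc n) = (2 * n + 1) * oddDoubleFact n

allVecs : (m k : ℕ) → List (Vec (Fin k) m)
allVecs zero k = []ᵥ ∷ []
allVecs (suc m) k = concatMap (λ v → map (λ x → x ∷ᵥ v) (allFin k)) (allVecs m k)

allB : {A : Set} → (A → Bool) → List A → Bool
allB p [] = true
allB p (x ∷ xs) = p x ∧ allB p xs

-- Permutations of [n] (one-line notation, values shifted to 0..n-1)
-- and interior peaks.

distinct : List ℕ → Bool
distinct [] = true
distinct (x ∷ xs) = allB (λ y → not (x ≡ᵇ y)) xs ∧ distinct xs

oneLine : {n : ℕ} → Vec (Fin n) n → List ℕ
oneLine v = map toℕ (toList v)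

isPerm : {n : ℕ} → Vec (Fin n) n → Bool
isPerm v = distinct (oneLine v)

peaks : List ℕ → ℕ
peaks (x ∷ y ∷ z ∷ r) = (if (x <ᵇ y) ∧ (z <ᵇ y) then 1 else 0) + peaks (y ∷ z ∷ r)
peaks _ = 0

P : ℕ → ℕ → ℕ
P n k = count (λ v → isPerm v ∧ (peaks (oneLine v) ≡ᵇ k)) (allVecs n n)

-- Perfect matchings of [2n], encoded as fixed-point-free involutions
-- f of {0,…,2n-1} (element t stands for t+1 ∈ [2n]); the blocks are
-- {t, f t}.  A block has odd smaller element (in [2n]) iff its smaller
-- element t (0-based) satisfies t < f t and t is even.

isFPFInvolution : {m : ℕ} → Vec (Fin m) m → Bool
isFPFInvolution {m} f =
  allB (λ t → (toℕ (lookup f (lookup f t)) ≡ᵇ toℕ t)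
              ∧ not (toℕ (lookup f t) ≡ᵇ toℕ t)) (allFin m)

oddBlocks : {m : ℕ} → Vec (Fin m) m → ℕ
oddBlocks {m} f =
  count (λ t → (toℕ t <ᵇ toℕ (lookup f t)) ∧ (toℕ t % 2 ≡ᵇ 0)) (allFin m)

N : ℕ → ℕ → ℕ
N n k = count (λ f → isFPFInvolution f ∧ (oddBlocks f ≡ᵇ k)) (allVecs (2 * n) (2 * n))

module Submission where

-- All parts are proved by comparing linear recurrences
-- in n with equal initial values, derived on each side as follows.
--   * Coefficients.  Pairing (XD)^n(Y) with a weight on monomials is a
--     linear functional, and XD acts on weights by the Leibniz rule.
--     Since (XD)^n(Y) is homogeneous of degree 2n + 1 and its terms have
--     a constrained shape (even X-exponent ≥ 2, Z-exponent ≡ n mod 2 and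
--     ≤ n, Y-exponent < n), this yields recurrences for the coefficient
--     of X^A Z^Z, for the X^A-coefficient sums and for the total sum,
--     plus vanishing results; b n i j is such a coefficient.
--   * Peaks.  Permutations of [0, n + 1) arise uniquely by inserting n
--     into a permutation of [0, n); inserting a maximum into a gap next
--     to a peak (or at an end) keeps the peak number, otherwise raises it.
--   * Matchings.  Matchings of [0, 2n + 2) arise uniquely from matchings
--     of [0, 2n), by adding the block {0, 1} or by opening a block {a, c}
--     into {0, a}, {1, c}; this changes the number of odd blocks by one
--     unless the opened block was odd.
-- Enumerations by the definitions (vectors) are first transported
-- to lists; finally part (i) is the total coefficient sum, (ii) compares
-- the X-coefficient recurrence with that of N, and (iii) compares the
-- diagonal and antidiagonal coefficient recurrences with that of P.

open import Defs
open import Data.Nat using (ℕ; zero; suc; _+_; _*_; _∸_; _/_; _%_; _≤_; _<_; z≤n; s≤s; _≡ᵇ_; _<ᵇ_; _≤ᵇ_; _≟_; _≤?_)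
open import Data.Nat.Properties
open import Data.Nat.DivMod using (m≡m%n+[m/n]*n; m%n<n; [m+n]%n≡m%n)
open import Data.Nat.Tactic.RingSolver using (solve-∀)
open import Data.Bool using (Bool; true; false; if_then_else_; _∧_; not)
open import Data.Bool.Properties using (T-≡; ∧-zeroʳ)
open import Data.Product using (_×_; _,_; Σ; proj₁; proj₂)
open import Data.Sum using (_⊎_; inj₁; inj₂)
open import Data.Empty using (⊥-elim)
open import Data.Fin using (Fin; toℕ) renaming (zero to fzero; suc to fsuc)
open import Data.Vec using (Vec; lookup; toList) renaming (_∷_ to _∷ᵥ_)
open import Data.List using (List; []; _∷_; map; concatMap; _++_; length; upTo; tabulate; applyUpTo; filterᵇ)
open import Data.List.Properties using (length-++; length-map; length-upTo; length-applyUpTo; upTo-∷ʳ; map-++; map-∘; map-tabulate)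
open import Data.List.Relation.Unary.All using (All; []; _∷_)
import Data.List.Relation.Unary.All as All
open import Data.List.Relation.Unary.Any using (here; there)
open import Data.List.Relation.Unary.AllPairs using ([]; _∷_)
open import Data.List.Relation.Unary.Unique.Propositional using (Unique)
import Data.List.Relation.Unary.Unique.Propositional.Properties as Unique
open import Data.List.Membership.Propositional using (_∈_; find; lose)
open import Data.List.Membership.DecPropositional _≟_ using (_∈?_)
open import Data.List.Membership.Propositional.Properties
  using (∈-++⁺ˡ; ∈-++⁺ʳ; ∈-++⁻; ∈-∃++; ∈-map⁺; ∈-map⁻; ∈-concatMap⁺; ∈-concatMap⁻; ∈-upTo⁺; ∈-upTo⁻; ∈-filter⁺; ∈-filter⁻)
open import Relation.Binary.PropositionalEquality
open import Relation.Nullary using (¬_; yes; no)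
open import Relation.Nullary.Decidable using (T?)
open import Function using (_∘_; id; Equivalence)

ind : Bool → ℕ
ind c = if c then 1 else 0

ind≤1 : ∀ c → ind c ≤ 1
ind≤1 true = ≤-refl
ind≤1 false = z≤n

if-ind : ∀ c k → (if c then k else 0) ≡ k * ind c
if-ind true k = sym (*-identityʳ k)
if-ind false k = sym (*-zeroʳ k)

∧-split : ∀ {c d} → (c ∧ d) ≡ true → c ≡ true × d ≡ true
∧-split {true} {true} _ = refl , refl

∧-intro : ∀ {c d} → c ≡ true → d ≡ true → (c ∧ d) ≡ true
∧-intro refl refl = refl

not-true : ∀ {c} → not c ≡ true → c ≡ false
not-true {false} _ = refl

≡ᵇ-sound : ∀ m n → (m ≡ᵇ n) ≡ true → m ≡ n
≡ᵇ-sound m n e = ≡ᵇ⇒≡ m n (Equivalence.from T-≡ e)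

≡ᵇ-true : ∀ {m n} → m ≡ n → (m ≡ᵇ n) ≡ true
≡ᵇ-true {m} {n} e = Equivalence.to T-≡ (≡⇒≡ᵇ m n e)

≡ᵇ-refl : ∀ m → (m ≡ᵇ m) ≡ true
≡ᵇ-refl m = ≡ᵇ-true {m} refl

≡ᵇ-false : ∀ m n → ¬ (m ≡ n) → (m ≡ᵇ n) ≡ false
≡ᵇ-false m n m≢n with m ≡ᵇ n in e
... | true = ⊥-elim (m≢n (≡ᵇ-sound m n e))
... | false = refl

<ᵇ-sound : ∀ m n → (m <ᵇ n) ≡ true → m < n
<ᵇ-sound m n e = <ᵇ⇒< m n (Equivalence.from T-≡ e)

<ᵇ-true : ∀ {m n} → m < n → (m <ᵇ n) ≡ true
<ᵇ-true m<n = Equivalence.to T-≡ (<⇒<ᵇ m<n)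

<ᵇ-false : ∀ m n → ¬ (m < n) → (m <ᵇ n) ≡ false
<ᵇ-false m n m≮n with m <ᵇ n in e
... | true = ⊥-elim (m≮n (<ᵇ-sound m n e))
... | false = refl

≤ᵇ-false-sound : ∀ m n → (m ≤ᵇ n) ≡ false → ¬ (m ≤ n)
≤ᵇ-false-sound m n e m≤n with trans (sym e) (Equivalence.to T-≡ (≤⇒≤ᵇ m≤n))
... | ()

δ : ℕ → ℕ → ℕ
δ x y = ind (x ≡ᵇ y)

δ-eq : ∀ {x y} → x ≡ y → δ x y ≡ 1
δ-eq e rewrite ≡ᵇ-true e = refl

δ-neq : ∀ {x y} → ¬ (x ≡ y) → δ x y ≡ 0
δ-neq {x} {y} x≢y rewrite ≡ᵇ-false x y x≢y = refl

δ-subst : ∀ x X (f : ℕ → ℕ) → δ x X * f x ≡ δ x X * f X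
δ-subst x X f with x ≟ X
... | yes refl = refl
... | no x≢X rewrite δ-neq x≢X = refl

δ-factor : ∀ x X → x * δ x X ≡ X * δ x X
δ-factor x X = trans (*-comm x _) (trans (δ-subst x X id) (*-comm _ X))

δ-factorˡ : ∀ x X c → x * (δ x X * c) ≡ X * (δ x X * c)
δ-factorˡ x X c = trans (sym (*-assoc x _ c)) (trans (cong (_* c) (δ-factor x X)) (*-assoc X _ c))

δ-factorʳ : ∀ x X c → x * (c * δ x X) ≡ X * (c * δ x X)
δ-factorʳ x X c = trans (cong (x *_) (*-comm c _)) (trans (δ-factorˡ x X c) (cong (X *_) (*-comm _ c)))

sumL : {A : Set} → (A → ℕ) → List A → ℕ
sumL f [] = 0
sumL f (x ∷ xs) = f x + sumL f xs

sumL-++ : {A : Set} (f : A → ℕ) (xs ys : List A) → sumL f (xs ++ ys) ≡ sumL f xs + sumL f ys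
sumL-++ f [] ys = refl
sumL-++ f (x ∷ xs) ys = trans (cong (f x +_) (sumL-++ f xs ys)) (sym (+-assoc (f x) _ _))

sumL-concatMap : {A B : Set} (f : B → ℕ) (g : A → List B) (xs : List A) →
  sumL f (concatMap g xs) ≡ sumL (λ x → sumL f (g x)) xs
sumL-concatMap f g [] = refl
sumL-concatMap f g (x ∷ xs) =
  trans (sumL-++ f (g x) (concatMap g xs)) (cong (sumL f (g x) +_) (sumL-concatMap f g xs))

sumL-cong : {A : Set} {f g : A → ℕ} (xs : List A) → (∀ {x} → x ∈ xs → f x ≡ g x) → sumL f xs ≡ sumL g xs
sumL-cong [] h = refl
sumL-cong (x ∷ xs) h = cong₂ _+_ (h (here refl)) (sumL-cong xs (h ∘ there))

sumL-+ : {A : Set} (f g : A → ℕ) (xs : List A) → sumL (λ x → f x + g x) xs ≡ sumL f xs + sumL g xs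
sumL-+ f g [] = refl
sumL-+ f g (x ∷ xs) rewrite sumL-+ f g xs = swap-middle (f x) (g x) (sumL f xs) (sumL g xs)
  where swap-middle : ∀ a b c d → a + b + (c + d) ≡ a + c + (b + d)
        swap-middle = solve-∀

sumL-* : {A : Set} (c : ℕ) (f : A → ℕ) (xs : List A) → sumL (λ x → c * f x) xs ≡ c * sumL f xs
sumL-* c f [] = sym (*-zeroʳ c)
sumL-* c f (x ∷ xs) rewrite sumL-* c f xs = sym (*-distribˡ-+ c (f x) (sumL f xs))

sumL-0 : {A : Set} (xs : List A) → sumL (λ _ → 0) xs ≡ 0
sumL-0 [] = refl
sumL-0 (x ∷ xs) = sumL-0 xs

count-sumL : {A : Set} (p : A → Bool) (xs : List A) → count p xs ≡ sumL (ind ∘ p) xs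
count-sumL p [] = refl
count-sumL p (x ∷ xs) = cong (ind (p x) +_) (count-sumL p xs)

count-map : {A B : Set} (p : B → Bool) (f : A → B) (xs : List A) → count p (map f xs) ≡ count (p ∘ f) xs
count-map p f [] = refl
count-map p f (x ∷ xs) = cong (ind (p (f x)) +_) (count-map p f xs)

count-cong : {A : Set} {p q : A → Bool} (xs : List A) → (∀ x → p x ≡ q x) → count p xs ≡ count q xs
count-cong [] h = refl
count-cong (x ∷ xs) h = cong₂ (λ c n → ind c + n) (h x) (count-cong xs h)

count-concatMap : {A B : Set} (q : B → Bool) (g : A → List B) (xs : List A) →
  count q (concatMap g xs) ≡ sumL (λ x → count q (g x)) xs
count-concatMap q g xs =
  trans (count-sumL q (concatMap g xs))
  (trans (sumL-concatMap (ind ∘ q) g xs) (sumL-cong xs (λ {x} _ → sym (count-sumL q (g x)))))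

sumTo-upTo : (f : ℕ → ℕ) (n : ℕ) → sumL f (upTo n) ≡ sumTo n f
sumTo-upTo f zero = refl
sumTo-upTo f (suc n) = begin
  sumL f (upTo (suc n))              ≡⟨ cong (sumL f) (sym (upTo-∷ʳ n)) ⟩
  sumL f (upTo n ++ n ∷ [])          ≡⟨ sumL-++ f (upTo n) (n ∷ []) ⟩
  sumL f (upTo n) + (f n + 0)        ≡⟨ cong₂ _+_ (sumTo-upTo f n) (+-identityʳ (f n)) ⟩
  sumTo n f + f n                    ∎
  where open ≡-Reasoning

count-upTo : (p : ℕ → Bool) (n : ℕ) → count p (upTo n) ≡ sumTo n (ind ∘ p)
count-upTo p n = trans (count-sumL p (upTo n)) (sumTo-upTo (ind ∘ p) n)

sumTo-cong : ∀ n {f g : ℕ → ℕ} → (∀ j → j < n → f j ≡ g j) → sumTo n f ≡ sumTo n g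
sumTo-cong zero h = refl
sumTo-cong (suc n) h = cong₂ _+_ (sumTo-cong n (λ j j<n → h j (m<n⇒m<1+n j<n))) (h n ≤-refl)

sumTo-+ : ∀ n (f g : ℕ → ℕ) → sumTo n (λ j → f j + g j) ≡ sumTo n f + sumTo n g
sumTo-+ zero f g = refl
sumTo-+ (suc n) f g rewrite sumTo-+ n f g = swap-middle (sumTo n f) (sumTo n g) (f n) (g n)
  where swap-middle : ∀ a b c d → a + b + (c + d) ≡ a + c + (b + d)
        swap-middle = solve-∀

sumTo-* : ∀ n c (f : ℕ → ℕ) → sumTo n (λ j → c * f j) ≡ c * sumTo n f
sumTo-* zero c f = sym (*-zeroʳ c)
sumTo-* (suc n) c f rewrite sumTo-* n c f = sym (*-distribˡ-+ c (sumTo n f) (f n))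

sumTo-*ʳ : ∀ n c (f : ℕ → ℕ) → sumTo n (λ j → f j * c) ≡ c * sumTo n f
sumTo-*ʳ n c f = trans (sumTo-cong n (λ j _ → *-comm (f j) c)) (sumTo-* n c f)

sumTo-0 : ∀ n {f : ℕ → ℕ} → (∀ j → j < n → f j ≡ 0) → sumTo n f ≡ 0
sumTo-0 zero h = refl
sumTo-0 (suc n) h rewrite sumTo-0 n (λ j j<n → h j (m<n⇒m<1+n j<n)) | h n ≤-refl = refl

sumTo-1 : ∀ n → sumTo n (λ _ → 1) ≡ n
sumTo-1 zero = refl
sumTo-1 (suc n) = trans (cong (_+ 1) (sumTo-1 n)) (+-comm n 1)

sumTo-head : ∀ n (f : ℕ → ℕ) → sumTo (suc n) f ≡ f 0 + sumTo n (f ∘ suc)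
sumTo-head zero f = +-comm 0 (f 0)
sumTo-head (suc n) f = trans (cong (_+ f (suc n)) (sumTo-head n f)) (+-assoc (f 0) _ _)

sumTo-complement : ∀ n (s : ℕ → ℕ) → (∀ j → j < n → s j ≤ 1) →
  sumTo n (λ j → 1 ∸ s j) ≡ n ∸ sumTo n s
sumTo-complement n s s≤1 =
  trans (sym (m+n∸m≡n (sumTo n s) _))
        (cong (_∸ sumTo n s) (trans (sym (sumTo-+ n s (λ j → 1 ∸ s j)))
                                    (trans (sumTo-cong n (λ j j<n → m+[n∸m]≡n (s≤1 j j<n))) (sumTo-1 n))))

ind-shift : ∀ v s p K → v + s ≡ suc p → s ≤ 1 → ind (v ≡ᵇ K) ≡ s * ind (p ≡ᵇ K) + (1 ∸ s) * ind (suc p ≡ᵇ K)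
ind-shift v zero p K e _ rewrite +-identityʳ v | e = sym (+-identityʳ _)
ind-shift v (suc zero) p K e _ rewrite suc-injective (trans (sym (+-comm v 1)) e) = trans (sym (+-identityʳ _)) (sym (+-identityʳ _))
ind-shift v (suc (suc s)) p K e (s≤s ())

sumTo-δ : ∀ n j₀ → j₀ < n → sumTo n (δ j₀) ≡ 1
sumTo-δ (suc n) j₀ j₀<1+n with j₀ ≟ n
... | yes refl = trans (cong (_+ δ j₀ j₀) (sumTo-0 n (λ j j<n → δ-neq (λ e → <-irrefl (sym e) j<n))))
                      (δ-eq {j₀} refl)
... | no j₀≢n = cong₂ _+_ (sumTo-δ n j₀ (≤∧≢⇒< (≤-pred j₀<1+n) j₀≢n)) (δ-neq j₀≢n)

sumTo-δ-inj : ∀ n (f : ℕ → ℕ) → (∀ {x y} → f x ≡ f y → x ≡ y) → ∀ j₀ → j₀ < n →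
  sumTo n (λ j → δ (f j₀) (f j)) ≡ 1
sumTo-δ-inj n f f-inj j₀ j₀<n = trans (sumTo-cong n (λ j _ → reindex j)) (sumTo-δ n j₀ j₀<n)
  where reindex : ∀ j → δ (f j₀) (f j) ≡ δ j₀ j
        reindex j with j₀ ≟ j
        ... | yes refl = trans (δ-eq {f j₀} refl) (sym (δ-eq {j₀} refl))
        ... | no j₀≢j = trans (δ-neq (j₀≢j ∘ f-inj)) (sym (δ-neq j₀≢j))

∈-concatMap-intro : {A B : Set} (g : A → List B) {x : A} {y : B} {xs : List A} →
  x ∈ xs → y ∈ g x → y ∈ concatMap g xs
∈-concatMap-intro g x∈xs y∈gx = ∈-concatMap⁺ g (lose x∈xs y∈gx)

∈-concatMap-elim : {A B : Set} (g : A → List B) (xs : List A) {y : B} →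
  y ∈ concatMap g xs → Σ A λ x → x ∈ xs × y ∈ g x
∈-concatMap-elim g xs y∈ = find (∈-concatMap⁻ g {xs} y∈)

All-∈ : {A : Set} {P : A → Set} (xs : List A) → (∀ {x} → x ∈ xs → P x) → All P xs
All-∈ [] h = []
All-∈ (x ∷ xs) h = h (here refl) ∷ All-∈ xs (h ∘ there)

∈-All : {A : Set} {P : A → Set} {xs : List A} {x : A} → All P xs → x ∈ xs → P x
∈-All (px ∷ _) (here refl) = px
∈-All (_ ∷ pxs) (there x∈) = ∈-All pxs x∈

Unique-map-on : {A B : Set} (f : A → B) (xs : List A) → Unique xs →
  (∀ {x y} → x ∈ xs → y ∈ xs → f x ≡ f y → x ≡ y) → Unique (map f xs)
Unique-map-on f [] [] inj = []
Unique-map-on f (x ∷ xs) (x∉ ∷ u) inj =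
  All-∈ (map f xs) (λ m e → let (y , y∈ , fy) = ∈-map⁻ f m in ∈-All x∉ y∈ (inj (here refl) (there y∈) (trans e fy)))
  ∷ Unique-map-on f xs u (λ x∈ y∈ → inj (there x∈) (there y∈))

Unique-concatMap : {A B : Set} (g : A → List B) (xs : List A) → Unique xs →
  (∀ {x} → x ∈ xs → Unique (g x)) →
  (∀ {x x' z} → x ∈ xs → x' ∈ xs → z ∈ g x → z ∈ g x' → x ≡ x') →
  Unique (concatMap g xs)
Unique-concatMap g [] _ _ _ = []
Unique-concatMap g (x ∷ xs) (x∉ ∷ u) ug disj =
  Unique.++⁺ (ug (here refl)) (Unique-concatMap g xs u (ug ∘ there) (λ a b → disj (there a) (there b)))
    (λ (z∈gx , z∈rest) → let (x' , x'∈ , z∈gx') = ∈-concatMap-elim g xs z∈rest in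
                         ∈-All x∉ x'∈ (disj (here refl) (there x'∈) z∈gx z∈gx'))

count-filterᵇ : {A : Set} (p : A → Bool) (xs : List A) → count p xs ≡ length (filterᵇ p xs)
count-filterᵇ p [] = refl
count-filterᵇ p (x ∷ xs) with p x
... | true = cong suc (count-filterᵇ p xs)
... | false = count-filterᵇ p xs

length-⊆ : {A : Set} (as : List A) {bs : List A} → Unique as → (∀ {x} → x ∈ as → x ∈ bs) → length as ≤ length bs
length-⊆ [] _ _ = z≤n
length-⊆ (a ∷ as) {bs} (a∉ ∷ u) as⊆bs with ∈-∃++ (as⊆bs (here refl))
... | bs₁ , bs₂ , refl =
  subst (suc (length as) ≤_) (sym length-split) (s≤s (length-⊆ as u as⊆bs₁bs₂))
  where
  length-split : length (bs₁ ++ a ∷ bs₂) ≡ suc (length (bs₁ ++ bs₂))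
  length-split = trans (length-++ bs₁) (trans (+-suc (length bs₁) (length bs₂)) (cong suc (sym (length-++ bs₁))))
  as⊆bs₁bs₂ : ∀ {x} → x ∈ as → x ∈ bs₁ ++ bs₂
  as⊆bs₁bs₂ {x} x∈ with ∈-++⁻ bs₁ (as⊆bs (there x∈))
  ... | inj₁ x∈₁ = ∈-++⁺ˡ x∈₁
  ... | inj₂ (here refl) = ⊥-elim (∈-All a∉ x∈ refl)
  ... | inj₂ (there x∈₂) = ∈-++⁺ʳ bs₁ x∈₂

count-≤ : {A B : Set} (p : A → Bool) (q : B → Bool) (f : A → B) (xs : List A) (ys : List B) → Unique xs →
  (∀ {x} → x ∈ xs → p x ≡ true → f x ∈ ys × q (f x) ≡ true) →
  (∀ {x y} → x ∈ xs → y ∈ xs → p x ≡ true → p y ≡ true → f x ≡ f y → x ≡ y) →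
  count p xs ≤ count q ys
count-≤ p q f xs ys u maps inj =
  subst₂ _≤_ (sym (trans (count-filterᵇ p xs) (sym (length-map f (filterᵇ p xs))))) (sym (count-filterᵇ q ys))
    (length-⊆ (map f (filterᵇ p xs))
      (Unique-map-on f (filterᵇ p xs) (Unique.filter⁺ (T? ∘ p) u)
        (λ x∈ y∈ → let (x∈xs , px) = ∈-filter⁻ (T? ∘ p) x∈ ; (y∈xs , py) = ∈-filter⁻ (T? ∘ p) y∈ in
                   inj x∈xs y∈xs (Equivalence.to T-≡ px) (Equivalence.to T-≡ py)))
      (λ m → let (x , x∈ , e) = ∈-map⁻ f m ; (x∈xs , px) = ∈-filter⁻ (T? ∘ p) x∈ ; (fx∈ , qfx) = maps x∈xs (Equivalence.to T-≡ px) in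
             subst (_∈ filterᵇ q ys) (sym e) (∈-filter⁺ (T? ∘ q) fx∈ (Equivalence.from T-≡ qfx))))

count-≡ : {A : Set} (p q : A → Bool) (xs ys : List A) → Unique xs → Unique ys →
  (∀ {x} → x ∈ xs → p x ≡ true → x ∈ ys × q x ≡ true) →
  (∀ {x} → x ∈ ys → q x ≡ true → x ∈ xs × p x ≡ true) →
  count p xs ≡ count q ys
count-≡ p q xs ys uxs uys xs⇒ys ys⇒xs =
  ≤-antisym (count-≤ p q id xs ys uxs xs⇒ys (λ _ _ _ _ e → e)) (count-≤ q p id ys xs uys ys⇒xs (λ _ _ _ _ e → e))

Weight : Set
Weight = ℕ → ℕ → ℕ → ℕ

weigh : Weight → Poly → ℕ
weigh w [] = 0
weigh w ((k , a , y , z) ∷ p) = k * w a y z + weigh w p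

weigh-++ : ∀ w p q → weigh w (p ++ q) ≡ weigh w p + weigh w q
weigh-++ w [] q = refl
weigh-++ w ((k , a , y , z) ∷ p) q = trans (cong (k * w a y z +_) (weigh-++ w p q)) (sym (+-assoc (k * w a y z) _ _))

weigh-+ : ∀ (w u : Weight) p → weigh (λ a y z → w a y z + u a y z) p ≡ weigh w p + weigh u p
weigh-+ w u [] = refl
weigh-+ w u ((k , a , y , z) ∷ p) rewrite weigh-+ w u p = distrib k (w a y z) (u a y z) (weigh w p) (weigh u p)
  where distrib : ∀ k x y A B → k * (x + y) + (A + B) ≡ k * x + A + (k * y + B)
        distrib = solve-∀

weigh-* : ∀ c (w : Weight) p → weigh (λ a y z → c * w a y z) p ≡ c * weigh w p
weigh-* c w [] = sym (*-zeroʳ c)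
weigh-* c w ((k , a , y , z) ∷ p) rewrite weigh-* c w p = distrib k c (w a y z) (weigh w p)
  where distrib : ∀ k c x A → k * (c * x) + c * A ≡ c * (k * x + A)
        distrib = solve-∀

weigh-0 : ∀ p → weigh (λ _ _ _ → 0) p ≡ 0
weigh-0 [] = refl
weigh-0 ((k , a , y , z) ∷ p) rewrite *-zeroʳ k = weigh-0 p

weigh-sumTo : ∀ n (w : ℕ → Weight) p → sumTo n (λ j → weigh (w j) p) ≡ weigh (λ a y z → sumTo n (λ j → w j a y z)) p
weigh-sumTo zero w p = sym (weigh-0 p)
weigh-sumTo (suc n) w p rewrite weigh-sumTo n w p = sym (weigh-+ (λ a y z → sumTo n (λ j → w j a y z)) (w n) p)

weigh-cong : ∀ {w u : Weight} (P : Term → Set) (p : Poly) →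
  (∀ k a y z → P (k , a , y , z) → k * w a y z ≡ k * u a y z) → All P p → weigh w p ≡ weigh u p
weigh-cong P [] h [] = refl
weigh-cong P ((k , a , y , z) ∷ p) h (pt ∷ pts) = cong₂ _+_ (h k a y z pt) (weigh-cong P p h pts)

weigh-vanish : ∀ {w : Weight} (P : Term → Set) (p : Poly) →
  (∀ k a y z → P (k , a , y , z) → k ≡ 0 ⊎ w a y z ≡ 0) → All P p → weigh w p ≡ 0
weigh-vanish {w} P p h pts = trans (weigh-cong {w} {λ _ _ _ → 0} P p zero-term pts) (weigh-0 p)
  where zero-term : ∀ k a y z → P (k , a , y , z) → k * w a y z ≡ k * 0
        zero-term k a y z pt with h k a y z pt
        ... | inj₁ refl = refl
        ... | inj₂ e = cong (k *_) e

weigh-ext : ∀ {w u : Weight} p → (∀ a y z → w a y z ≡ u a y z) → weigh w p ≡ weigh u p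
weigh-ext [] h = refl
weigh-ext ((k , a , y , z) ∷ p) h = cong₂ (λ v r → k * v + r) (h a y z) (weigh-ext p h)

D* : Weight → Weight
D* w a y z = a * w (a ∸ 1) (suc y) (suc z) + (y * w (suc a) (y ∸ 1) (suc z) + z * w (suc a) (suc y) (z ∸ 1))

weigh-D : ∀ w p → weigh w (D p) ≡ weigh (D* w) p
weigh-D w [] = refl
weigh-D w ((k , a , y , z) ∷ p) =
  trans (weigh-++ w (DTerm (k , a , y , z)) (D p))
        (cong₂ _+_ (distrib k a y z (w (a ∸ 1) (suc y) (suc z)) (w (suc a) (y ∸ 1) (suc z)) (w (suc a) (suc y) (z ∸ 1)))
                   (weigh-D w p))
  where distrib : ∀ k a y z u v s → k * a * u + (k * y * v + (k * z * s + 0)) ≡ k * (a * u + (y * v + z * s))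
        distrib = solve-∀

weigh-mulX : ∀ w p → weigh w (mulX p) ≡ weigh (λ a y z → w (suc a) y z) p
weigh-mulX w [] = refl
weigh-mulX w ((k , a , y , z) ∷ p) = cong (k * w (suc a) y z +_) (weigh-mulX w p)

-- The dual of XD, simplified using a · f(a ∸ 1 + 1) = a · f(a).
XD* : Weight → Weight
XD* w a y z = a * w a (suc y) (suc z) + (y * w (suc (suc a)) (y ∸ 1) (suc z) + z * w (suc (suc a)) (suc y) (z ∸ 1))

weigh-XD : ∀ w n → weigh w (XDpow (suc n)) ≡ weigh (XD* w) (XDpow n)
weigh-XD w n =
  trans (weigh-mulX w (D (XDpow n)))
  (trans (weigh-D (λ a y z → w (suc a) y z) (XDpow n)) (weigh-ext (XDpow n) pred-suc))
  where pred-suc : ∀ a y z → D* (λ a y z → w (suc a) y z) a y z ≡ XD* w a y z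
        pred-suc zero y z = refl
        pred-suc (suc a) y z = refl

All-XD : ∀ {P Q : Term → Set} (p : Poly) →
  (∀ {k a y z} → P (k , a , y , z) → All Q (mulX (DTerm (k , a , y , z)))) → All P p → All Q (mulX (D p))
All-XD [] step [] = []
All-XD ((k , a , y , z) ∷ p) step (pt ∷ pts) = All-mulX-++ (DTerm (k , a , y , z)) (step pt) (All-XD p step pts)
  where All-mulX-++ : ∀ {Q : Term → Set} xs {ys} → All Q (mulX xs) → All Q (mulX ys) → All Q (mulX (xs ++ ys))
        All-mulX-++ [] [] q = q
        All-mulX-++ (t ∷ xs) (qt ∷ qs) q = qt ∷ All-mulX-++ xs qs q

-- (XD)^n(Y) is homogeneous of degree 2n + 1: XD raises the degree by 2.
Homogeneous : ℕ → Term → Set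
Homogeneous d (k , a , y , z) = k ≡ 0 ⊎ a + y + z ≡ d

homogeneous : ∀ n → All (Homogeneous (2 * n + 1)) (XDpow n)
homogeneous zero = inj₂ refl ∷ []
homogeneous (suc n) = All-XD (XDpow n) step (homogeneous n)
  where
  raise : ∀ {d} → d ≡ 2 * n + 1 → d + 2 ≡ 2 * suc n + 1
  raise refl = lemma n
    where lemma : ∀ n → 2 * n + 1 + 2 ≡ 2 * suc n + 1
          lemma = solve-∀
  term₁ : ∀ k a y z → a + y + z ≡ 2 * n + 1 → Homogeneous (2 * suc n + 1) (k * a , suc (a ∸ 1) , suc y , suc z)
  term₁ k zero y z e = inj₁ (*-zeroʳ k)
  term₁ k (suc a) y z e = inj₂ (trans (shuffle a y z) (raise e))
    where shuffle : ∀ a y z → suc a + suc y + suc z ≡ suc a + y + z + 2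
          shuffle = solve-∀
  term₂ : ∀ k a y z → a + y + z ≡ 2 * n + 1 → Homogeneous (2 * suc n + 1) (k * y , suc (suc a) , y ∸ 1 , suc z)
  term₂ k a zero z e = inj₁ (*-zeroʳ k)
  term₂ k a (suc y) z e = inj₂ (trans (shuffle a y z) (raise e))
    where shuffle : ∀ a y z → suc (suc a) + y + suc z ≡ a + suc y + z + 2
          shuffle = solve-∀
  term₃ : ∀ k a y z → a + y + z ≡ 2 * n + 1 → Homogeneous (2 * suc n + 1) (k * z , suc (suc a) , suc y , z ∸ 1)
  term₃ k a y zero e = inj₁ (*-zeroʳ k)
  term₃ k a y (suc z) e = inj₂ (trans (shuffle a y z) (raise e))
    where shuffle : ∀ a y z → suc (suc a) + suc y + z ≡ a + y + suc z + 2
          shuffle = solve-∀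
  step : ∀ {k a y z} → Homogeneous (2 * n + 1) (k , a , y , z) → All (Homogeneous (2 * suc n + 1)) (mulX (DTerm (k , a , y , z)))
  step (inj₁ refl) = inj₁ refl ∷ inj₁ refl ∷ inj₁ refl ∷ []
  step {k} {a} {y} {z} (inj₂ e) = term₁ k a y z e ∷ term₂ k a y z e ∷ term₃ k a y z e ∷ []

parity : ℕ → ℕ
parity zero = 0
parity (suc zero) = 1
parity (suc (suc n)) = parity n

parity-% : ∀ n → n % 2 ≡ parity n
parity-% zero = refl
parity-% (suc zero) = refl
parity-% (suc (suc n)) = trans (trans (cong (_% 2) (+-comm 2 n)) ([m+n]%n≡m%n n 2)) (parity-% n)

parity-alternates : ∀ m → (parity m ≡ 0 × parity (suc m) ≡ 1) ⊎ (parity m ≡ 1 × parity (suc m) ≡ 0)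
parity-alternates zero = inj₁ (refl , refl)
parity-alternates (suc zero) = inj₂ (refl , refl)
parity-alternates (suc (suc m)) = parity-alternates m

SameParity : ℕ → ℕ → Set
SameParity m z = Σ ℕ λ j → z ≡ 2 * j + parity m

SameParity-suc : ∀ m {z} → SameParity m z → SameParity (suc m) (suc z)
SameParity-suc m (j , refl) with parity-alternates m
... | inj₁ (p₀ , p₁) rewrite p₀ | p₁ = j , lemma j
  where lemma : ∀ j → suc (2 * j + 0) ≡ 2 * j + 1
        lemma = solve-∀
... | inj₂ (p₀ , p₁) rewrite p₀ | p₁ = suc j , lemma j
  where lemma : ∀ j → suc (2 * j + 1) ≡ 2 * suc j + 0
        lemma = solve-∀

SameParity-pred : ∀ m {z} → SameParity m (suc z) → SameParity (suc m) z
SameParity-pred m {z} (j , e) with parity-alternates m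
... | inj₁ (p₀ , p₁) rewrite p₀ | p₁ = pred-even j e
  where pred-even : ∀ j → suc z ≡ 2 * j + 0 → Σ ℕ λ j' → z ≡ 2 * j' + 1
        pred-even zero ()
        pred-even (suc j) e = j , suc-injective (trans e (lemma j))
          where lemma : ∀ j → 2 * suc j + 0 ≡ suc (2 * j + 1)
                lemma = solve-∀
... | inj₂ (p₀ , p₁) rewrite p₀ | p₁ = j , suc-injective (trans e (lemma j))
  where lemma : ∀ j → 2 * j + 1 ≡ suc (2 * j + 0)
        lemma = solve-∀

Shaped : ℕ → Term → Set
Shaped m (k , a , y , z) = k ≡ 0 ⊎ ((Σ ℕ λ i → a ≡ suc (suc (2 * i))) × SameParity m z × z ≤ m × suc y ≤ m)

shaped : ∀ m → All (Shaped (suc m)) (XDpow (suc m))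
shaped zero = inj₁ refl ∷ inj₂ ((0 , refl) , (0 , refl) , s≤s z≤n , s≤s z≤n) ∷ inj₁ refl ∷ []
shaped (suc m) = All-XD (XDpow (suc m)) step (shaped m)
  where
  M = suc m
  even-step : ∀ i → suc (suc (suc (suc (2 * i)))) ≡ suc (suc (2 * suc i))
  even-step = solve-∀
  step : ∀ {k a y z} → Shaped M (k , a , y , z) → All (Shaped (suc M)) (mulX (DTerm (k , a , y , z)))
  step (inj₁ refl) = inj₁ refl ∷ inj₁ refl ∷ inj₁ refl ∷ []
  step {k} {.(suc (suc (2 * i)))} {y} {z} (inj₂ ((i , refl) , z-par , z≤M , y<M)) = term₁ ∷ term₂ y y<M ∷ term₃ z z-par z≤M ∷ []
    where
    term₁ : Shaped (suc M) (k * suc (suc (2 * i)) , suc (suc (2 * i)) , suc y , suc z)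
    term₁ = inj₂ ((i , refl) , SameParity-suc M z-par , s≤s z≤M , s≤s y<M)
    term₂ : ∀ y → suc y ≤ M → Shaped (suc M) (k * y , suc (suc (suc (suc (2 * i)))) , y ∸ 1 , suc z)
    term₂ zero _ = inj₁ (*-zeroʳ k)
    term₂ (suc y) y<M = inj₂ ((suc i , even-step i) , SameParity-suc M z-par , s≤s z≤M , s≤s (≤-trans (n≤1+n y) (≤-trans (n≤1+n (suc y)) y<M)))
    term₃ : ∀ z → SameParity M z → z ≤ M → Shaped (suc M) (k * z , suc (suc (suc (suc (2 * i)))) , suc y , z ∸ 1)
    term₃ zero _ _ = inj₁ (*-zeroʳ k)
    term₃ (suc z) z-par z≤M = inj₂ ((suc i , even-step i) , SameParity-pred M z-par , ≤-trans (n≤1+n z) (≤-trans z≤M (n≤1+n M)) , s≤s y<M)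

-- Coefficients of (XD)^n(Y).  By homogeneity a monomial is determined by
-- its X- and Z-exponents, so the coefficient of X^A Z^Z (any Y-power)
-- is the coefficient of X^A Y^{2n+1-A-Z} Z^Z.

atXZ : ℕ → ℕ → Weight
atXZ A Z a y z = δ a A * δ z Z

atX : ℕ → Weight
atX A a y z = δ a A

xzCoeff : ℕ → ℕ → ℕ → ℕ
xzCoeff n A Z = weigh (atXZ A Z) (XDpow n)

xCoeff : ℕ → ℕ → ℕ
xCoeff n A = weigh (atX A) (XDpow n)

coeffSum : ℕ → ℕ
coeffSum n = weigh (λ _ _ _ → 1) (XDpow n)

weigh-XD-hom : ∀ n (w u : Weight) → (∀ a y z → a + y + z ≡ 2 * n + 1 → XD* w a y z ≡ u a y z) →
  weigh w (XDpow (suc n)) ≡ weigh u (XDpow n)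
weigh-XD-hom n w u h = trans (weigh-XD w n) (weigh-cong (Homogeneous (2 * n + 1)) (XDpow n) on-term (homogeneous n))
  where on-term : ∀ k a y z → Homogeneous (2 * n + 1) (k , a , y , z) → k * XD* w a y z ≡ k * u a y z
        on-term _ _ _ _ (inj₁ refl) = refl
        on-term k a y z (inj₂ e) = cong (k *_) (h a y z e)

weigh-lin₂ : ∀ c₁ c₂ (w₁ w₂ : Weight) p →
  weigh (λ a y z → c₁ * w₁ a y z + c₂ * w₂ a y z) p ≡ c₁ * weigh w₁ p + c₂ * weigh w₂ p
weigh-lin₂ c₁ c₂ w₁ w₂ p =
  trans (weigh-+ (λ a y z → c₁ * w₁ a y z) (λ a y z → c₂ * w₂ a y z) p) (cong₂ _+_ (weigh-* c₁ w₁ p) (weigh-* c₂ w₂ p))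

weigh-lin₃ : ∀ c₁ c₂ c₃ (w₁ w₂ w₃ : Weight) p →
  weigh (λ a y z → c₁ * w₁ a y z + (c₂ * w₂ a y z + c₃ * w₃ a y z)) p ≡ c₁ * weigh w₁ p + (c₂ * weigh w₂ p + c₃ * weigh w₃ p)
weigh-lin₃ c₁ c₂ c₃ w₁ w₂ w₃ p =
  trans (weigh-+ (λ a y z → c₁ * w₁ a y z) (λ a y z → c₂ * w₂ a y z + c₃ * w₃ a y z) p)
        (cong₂ _+_ (weigh-* c₁ w₁ p) (weigh-lin₂ c₂ c₃ w₂ w₃ p))

Y-exponent : ∀ {d} a y z → a + y + z ≡ d → d ∸ (a + z) ≡ y
Y-exponent a y z refl = trans (cong (_∸ (a + z)) (shuffle a y z)) (m+n∸m≡n (a + z) y)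
  where shuffle : ∀ a y z → a + y + z ≡ a + z + y
        shuffle = solve-∀

Y-factor : ∀ {d} a y z A Z → a + y + z ≡ d → y * atXZ A Z a y z ≡ (d ∸ (A + Z)) * atXZ A Z a y z
Y-factor {d} a y z A Z deg with a ≟ A | z ≟ Z
... | yes refl | yes refl rewrite ≡ᵇ-refl a | ≡ᵇ-refl z = cong (_* 1) (sym (Y-exponent a y z deg))
... | no a≢A | _ rewrite δ-neq a≢A | *-zeroʳ y | *-zeroʳ (d ∸ (A + Z)) = refl
... | yes refl | no z≢Z rewrite δ-neq z≢Z | *-zeroʳ (δ a a) | *-zeroʳ y | *-zeroʳ (d ∸ (a + Z)) = refl

xzCoeff-rec : ∀ n A Z → xzCoeff (suc n) (suc (suc A)) (suc Z) ≡
  suc (suc A) * xzCoeff n (suc (suc A)) Z + ((2 * n + 1 ∸ (A + Z)) * xzCoeff n A Z + suc (suc Z) * xzCoeff n A (suc (suc Z)))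
xzCoeff-rec n A Z =
  trans (weigh-XD-hom n (atXZ (suc (suc A)) (suc Z)) _ on-monomial)
        (weigh-lin₃ (suc (suc A)) (2 * n + 1 ∸ (A + Z)) (suc (suc Z)) (atXZ (suc (suc A)) Z) (atXZ A Z) (atXZ A (suc (suc Z))) (XDpow n))
  where
  lower-Z : ∀ z c → z * (c * δ (z ∸ 1) (suc Z)) ≡ suc (suc Z) * (c * δ z (suc (suc Z)))
  lower-Z zero c = sym (trans (cong (suc (suc Z) *_) (*-zeroʳ c)) (*-zeroʳ (suc (suc Z))))
  lower-Z (suc z) c = δ-factorʳ (suc z) (suc (suc Z)) c
  on-monomial : ∀ a y z → a + y + z ≡ 2 * n + 1 → XD* (atXZ (suc (suc A)) (suc Z)) a y z ≡
    suc (suc A) * atXZ (suc (suc A)) Z a y z + ((2 * n + 1 ∸ (A + Z)) * atXZ A Z a y z + suc (suc Z) * atXZ A (suc (suc Z)) a y z)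
  on-monomial a y z deg = cong₂ _+_ (δ-factorˡ a (suc (suc A)) (δ z Z)) (cong₂ _+_ (Y-factor a y z A Z deg) (lower-Z z (δ a A)))

-- The Z^0 case: only the Z-lowering summand of XD contributes.
xzCoeff-rec₀ : ∀ n A → xzCoeff (suc n) (suc (suc A)) 0 ≡ xzCoeff n A 1
xzCoeff-rec₀ n A = weigh-XD-hom n (atXZ (suc (suc A)) 0) (atXZ A 1) on-monomial
  where
  lower-Z : ∀ z → z * δ (z ∸ 1) 0 ≡ δ z 1
  lower-Z zero = refl
  lower-Z (suc zero) = refl
  lower-Z (suc (suc z)) = *-zeroʳ (suc (suc z))
  on-monomial : ∀ a y z → a + y + z ≡ 2 * n + 1 → XD* (atXZ (suc (suc A)) 0) a y z ≡ atXZ A 1 a y z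
  on-monomial a y z _ rewrite *-zeroʳ (δ a (suc (suc A))) | *-zeroʳ a | *-zeroʳ (δ a A) | *-zeroʳ y
    | sym (*-assoc z (δ a A) (δ (z ∸ 1) 0)) | *-comm z (δ a A) | *-assoc (δ a A) z (δ (z ∸ 1) 0) | lower-Z z = refl

-- Summing over Z: the Y- and Z-lowering summands merge, with factor 2n + 1 - A.
xCoeff-rec : ∀ n A → xCoeff (suc n) (suc (suc A)) ≡ suc (suc A) * xCoeff n (suc (suc A)) + (2 * n + 1 ∸ A) * xCoeff n A
xCoeff-rec n A =
  trans (weigh-XD-hom n (atX (suc (suc A))) _ on-monomial) (weigh-lin₂ (suc (suc A)) (2 * n + 1 ∸ A) (atX (suc (suc A))) (atX A) (XDpow n))
  where
  on-monomial : ∀ a y z → a + y + z ≡ 2 * n + 1 → XD* (atX (suc (suc A))) a y z ≡ suc (suc A) * δ a (suc (suc A)) + (2 * n + 1 ∸ A) * δ a A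
  on-monomial a y z deg = cong₂ _+_ (δ-factor a (suc (suc A))) (trans (sym (*-distribʳ-+ (δ a A) y z)) YZ-factor)
    where
    YZ-factor : (y + z) * δ a A ≡ (2 * n + 1 ∸ A) * δ a A
    YZ-factor with a ≟ A
    ... | yes refl rewrite ≡ᵇ-refl a =
      cong (_* 1) (sym (trans (cong (_∸ a) (sym (trans (sym (+-assoc a y z)) deg))) (m+n∸m≡n a (y + z))))
    ... | no a≢A rewrite δ-neq a≢A | *-zeroʳ (y + z) | *-zeroʳ (2 * n + 1 ∸ A) = refl

xCoeff-0 : ∀ n → xCoeff (suc n) 0 ≡ 0
xCoeff-0 n = trans (weigh-XD-hom n (atX 0) (λ _ _ _ → 0) on-monomial) (weigh-0 (XDpow n))
  where on-monomial : ∀ a y z → _ → XD* (atX 0) a y z ≡ 0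
        on-monomial a y z _ rewrite *-zeroʳ y | *-zeroʳ z | δ-factor a 0 = refl

coeffSum-rec : ∀ n → coeffSum (suc n) ≡ (2 * n + 1) * coeffSum n
coeffSum-rec n = trans (weigh-XD-hom n (λ _ _ _ → 1) (λ _ _ _ → (2 * n + 1) * 1) on-monomial) (weigh-* (2 * n + 1) (λ _ _ _ → 1) (XDpow n))
  where on-monomial : ∀ a y z → a + y + z ≡ 2 * n + 1 → XD* (λ _ _ _ → 1) a y z ≡ (2 * n + 1) * 1
        on-monomial a y z deg rewrite *-identityʳ a | *-identityʳ y | *-identityʳ z | *-identityʳ (2 * n + 1) = trans (sym (+-assoc a y z)) deg

coeffSum-oddDoubleFact : ∀ n → coeffSum n ≡ oddDoubleFact n
coeffSum-oddDoubleFact zero = refl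
coeffSum-oddDoubleFact (suc n) = trans (coeffSum-rec n) (cong ((2 * n + 1) *_) (coeffSum-oddDoubleFact n))

WellShaped : ℕ → Term → Set
WellShaped m t = Homogeneous (2 * suc m + 1) t × Shaped (suc m) t

wellShaped : ∀ m → All (WellShaped m) (XDpow (suc m))
wellShaped m = All.zip (homogeneous (suc m) , shaped m)

xzCoeff-Z>m : ∀ m A Z → suc m < Z → xzCoeff (suc m) A Z ≡ 0
xzCoeff-Z>m m A Z m<Z = weigh-vanish (WellShaped m) (XDpow (suc m)) on-term (wellShaped m)
  where on-term : ∀ k a y z → WellShaped m (k , a , y , z) → k ≡ 0 ⊎ atXZ A Z a y z ≡ 0
        on-term _ _ _ _ (_ , inj₁ k≡0) = inj₁ k≡0
        on-term k a y z (_ , inj₂ (_ , _ , z≤m , _)) =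
          inj₂ (trans (cong (δ a A *_) (δ-neq (λ z≡Z → <-irrefl refl (≤-trans m<Z (subst (_≤ suc m) z≡Z z≤m))))) (*-zeroʳ (δ a A)))

xzCoeff-X⁰ : ∀ m Z → xzCoeff (suc m) 0 Z ≡ 0
xzCoeff-X⁰ m Z = weigh-vanish (WellShaped m) (XDpow (suc m)) on-term (wellShaped m)
  where on-term : ∀ k a y z → WellShaped m (k , a , y , z) → k ≡ 0 ⊎ atXZ 0 Z a y z ≡ 0
        on-term _ _ _ _ (_ , inj₁ k≡0) = inj₁ k≡0
        on-term _ _ _ _ (_ , inj₂ ((i , refl) , _)) = inj₂ refl

-- Since the Y-exponent is below m + 1, X- and Z-exponents sum to at least m + 3.
xzCoeff-small : ∀ m A Z → A + Z ≤ suc (suc m) → xzCoeff (suc m) A Z ≡ 0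
xzCoeff-small m A Z A+Z≤ = weigh-vanish (WellShaped m) (XDpow (suc m)) on-term (wellShaped m)
  where
  on-term : ∀ k a y z → WellShaped m (k , a , y , z) → k ≡ 0 ⊎ atXZ A Z a y z ≡ 0
  on-term _ _ _ _ (inj₁ k≡0 , _) = inj₁ k≡0
  on-term _ _ _ _ (_ , inj₁ k≡0) = inj₁ k≡0
  on-term k a y z (inj₂ deg , inj₂ (_ , _ , _ , y<m)) with a ≟ A | z ≟ Z
  ... | yes refl | yes refl = ⊥-elim (<-irrefl deg (≤-trans (≤-reflexive (cong suc (shuffle a y z))) too-small))
    where shuffle : ∀ a y z → a + y + z ≡ a + z + y
          shuffle = solve-∀
          degree : ∀ m → suc (suc (suc m)) + m ≡ 2 * suc m + 1
          degree = solve-∀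
          too-small : suc (a + z + y) ≤ 2 * suc m + 1
          too-small = ≤-trans (+-mono-≤ (s≤s A+Z≤) (≤-pred y<m)) (≤-reflexive (degree m))
  ... | no a≢A | _ = inj₂ (cong (_* δ z Z) (δ-neq a≢A))
  ... | yes refl | no z≢Z = inj₂ (trans (cong (δ a a *_) (δ-neq z≢Z)) (*-zeroʳ (δ a a)))

coeff-weigh : ∀ p A Y Z → coeff p A Y Z ≡ weigh (λ a y z → ind ((a ≡ᵇ A) ∧ (y ≡ᵇ Y) ∧ (z ≡ᵇ Z))) p
coeff-weigh [] A Y Z = refl
coeff-weigh ((k , a , y , z) ∷ p) A Y Z = cong₂ _+_ (if-ind ((a ≡ᵇ A) ∧ (y ≡ᵇ Y) ∧ (z ≡ᵇ Z)) k) (coeff-weigh p A Y Z)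

coeff-homogeneous : ∀ p A Z d → All (Homogeneous d) p →
  (if (A + Z) ≤ᵇ d then coeff p A (d ∸ (A + Z)) Z else 0) ≡ weigh (atXZ A Z) p
coeff-homogeneous p A Z d hom with (A + Z) ≤ᵇ d in fits
... | true = trans (coeff-weigh p A (d ∸ (A + Z)) Z) (weigh-cong (Homogeneous d) p on-term hom)
  where
  on-term : ∀ k a y z → Homogeneous d (k , a , y , z) → k * ind ((a ≡ᵇ A) ∧ (y ≡ᵇ (d ∸ (A + Z))) ∧ (z ≡ᵇ Z)) ≡ k * atXZ A Z a y z
  on-term _ _ _ _ (inj₁ refl) = refl
  on-term k a y z (inj₂ deg) with a ≟ A | z ≟ Z
  ... | yes refl | yes refl rewrite ≡ᵇ-refl a | ≡ᵇ-refl z | ≡ᵇ-true {y} {d ∸ (a + z)} (sym (Y-exponent a y z deg)) = refl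
  ... | no a≢A | _ rewrite ≡ᵇ-false a A a≢A = refl
  ... | yes refl | no z≢Z rewrite ≡ᵇ-refl a | ≡ᵇ-false z Z z≢Z | ∧-zeroʳ (y ≡ᵇ (d ∸ (a + Z))) = refl
... | false = sym (weigh-vanish (Homogeneous d) p on-term hom)
  where
  on-term : ∀ k a y z → Homogeneous d (k , a , y , z) → k ≡ 0 ⊎ atXZ A Z a y z ≡ 0
  on-term _ _ _ _ (inj₁ k≡0) = inj₁ k≡0
  on-term k a y z (inj₂ deg) with a ≟ A | z ≟ Z
  ... | yes refl | yes refl = ⊥-elim (≤ᵇ-false-sound (a + z) d fits (subst (a + z ≤_) deg (+-monoˡ-≤ z (m≤m+n a y))))
  ... | no a≢A | _ = inj₂ (cong (_* δ z Z) (δ-neq a≢A))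
  ... | yes refl | no z≢Z = inj₂ (trans (cong (δ a a *_) (δ-neq z≢Z)) (*-zeroʳ (δ a a)))

b-xzCoeff : ∀ n i j → b n i j ≡ xzCoeff n (2 * i + 2) (2 * j + n % 2)
b-xzCoeff n i j = coeff-homogeneous (XDpow n) (2 * i + 2) (2 * j + n % 2) (2 * n + 1) (homogeneous n)

-- Summing over j: the Z-exponent of every term is 2j + parity for a unique j ≤ m + 1.
b-row-sum : ∀ m i → sumTo (suc (suc m)) (λ j → b (suc m) i j) ≡ xCoeff (suc m) (suc (suc (2 * i)))
b-row-sum m i =
  trans (sumTo-cong (suc (suc m)) (λ j _ → trans (b-xzCoeff (suc m) i j) (cong₂ (xzCoeff (suc m)) (+-comm (2 * i) 2) (cong (2 * j +_) (parity-% (suc m))))))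
  (trans (weigh-sumTo (suc (suc m)) (λ j → atXZ A (Zexp j)) (XDpow (suc m)))
         (weigh-cong (WellShaped m) (XDpow (suc m)) on-term (wellShaped m)))
  where
  A = suc (suc (2 * i))
  Zexp : ℕ → ℕ
  Zexp j = 2 * j + parity (suc m)
  Zexp-inj : ∀ {x y} → Zexp x ≡ Zexp y → x ≡ y
  Zexp-inj {x} {y} e = *-cancelˡ-≡ x y 2 (+-cancelʳ-≡ (parity (suc m)) (2 * x) (2 * y) e)
  on-term : ∀ k a y z → WellShaped m (k , a , y , z) → k * sumTo (suc (suc m)) (λ j → atXZ A (Zexp j) a y z) ≡ k * atX A a y z
  on-term _ _ _ _ (_ , inj₁ refl) = refl
  on-term k a y z (_ , inj₂ (_ , (j₀ , refl) , z≤ , _)) = cong (k *_)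
    (trans (sumTo-* (suc (suc m)) (δ a A) (λ j → δ (Zexp j₀) (Zexp j)))
    (trans (cong (δ a A *_) (sumTo-δ-inj (suc (suc m)) Zexp Zexp-inj j₀ (s≤s (≤-trans (m≤m+n j₀ (j₀ + 0)) (≤-trans (m≤m+n (2 * j₀) _) z≤)))))
           (*-identityʳ (δ a A))))

xCoeff-even-sum : ∀ m → sumTo (suc (suc m)) (λ i → xCoeff (suc m) (suc (suc (2 * i)))) ≡ coeffSum (suc m)
xCoeff-even-sum m =
  trans (weigh-sumTo (suc (suc m)) (λ i → atX (suc (suc (2 * i)))) (XDpow (suc m)))
        (weigh-cong (WellShaped m) (XDpow (suc m)) on-term (wellShaped m))
  where
  Xexp-inj : ∀ {x y} → suc (suc (2 * x)) ≡ suc (suc (2 * y)) → x ≡ y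
  Xexp-inj {x} {y} e = *-cancelˡ-≡ x y 2 (suc-injective (suc-injective e))
  i-bound : ∀ i y z → suc (suc (2 * i)) + y + z ≡ 2 * suc m + 1 → i < suc (suc m)
  i-bound i y z deg with i ≤? suc m
  ... | yes i≤ = s≤s i≤
  ... | no i≰ = ⊥-elim (<-irrefl refl (≤-trans (≤-reflexive (lemma m)) (≤-trans (*-monoʳ-≤ 2 (≰⇒> i≰)) (≤-trans 2i≤ (≤-reflexive deg)))))
    where lemma : ∀ m → suc (2 * suc m + 1) ≡ 2 * suc (suc m)
          lemma = solve-∀
          2i≤ : 2 * i ≤ suc (suc (2 * i)) + y + z
          2i≤ = ≤-trans (≤-trans (n≤1+n (2 * i)) (n≤1+n (suc (2 * i)))) (≤-trans (m≤m+n _ y) (m≤m+n _ z))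
  on-term : ∀ k a y z → WellShaped m (k , a , y , z) → k * sumTo (suc (suc m)) (λ i → atX (suc (suc (2 * i))) a y z) ≡ k * 1
  on-term _ _ _ _ (_ , inj₁ refl) = refl
  on-term _ _ _ _ (inj₁ refl , _) = refl
  on-term k a y z (inj₂ deg , inj₂ ((i₀ , refl) , _)) =
    cong (k *_) (sumTo-δ-inj (suc (suc m)) (λ i → suc (suc (2 * i))) Xexp-inj i₀ (i-bound i₀ y z deg))

entries : ∀ {m k} → Vec (Fin k) m → List ℕ
entries v = map toℕ (toList v)

words : ℕ → ℕ → List (List ℕ)
words zero k = [] ∷ []
words (suc m) k = concatMap (λ l → map (_∷ l) (upTo k)) (words m k)

tabulate-toℕ : ∀ {A : Set} n (f : ℕ → A) → tabulate {n = n} (f ∘ toℕ) ≡ applyUpTo f n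
tabulate-toℕ zero f = refl
tabulate-toℕ (suc n) f = cong (f 0 ∷_) (tabulate-toℕ n (f ∘ suc))

allFin-toℕ : ∀ k → map toℕ (allFin k) ≡ upTo k
allFin-toℕ k = trans (map-tabulate id toℕ) (tabulate-toℕ k id)

entries-allVecs : ∀ m k → map entries (allVecs m k) ≡ words m k
entries-allVecs zero k = refl
entries-allVecs (suc m) k =
  trans (entries-step (allVecs m k)) (cong (concatMap (λ l → map (_∷ l) (upTo k))) (entries-allVecs m k))
  where
  extend : ∀ (v : Vec (Fin k) m) → map entries (map (_∷ᵥ v) (allFin k)) ≡ map (_∷ entries v) (upTo k)
  extend v = trans (sym (map-∘ (allFin k))) (trans (map-∘ (allFin k)) (cong (map (_∷ entries v)) (allFin-toℕ k)))
  entries-step : ∀ vs → map entries (concatMap (λ v → map (_∷ᵥ v) (allFin k)) vs) ≡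
                        concatMap (λ l → map (_∷ l) (upTo k)) (map entries vs)
  entries-step [] = refl
  entries-step (v ∷ vs) = trans (map-++ entries (map (_∷ᵥ v) (allFin k)) _) (cong₂ _++_ (extend v) (entries-step vs))

count-allVecs : ∀ m k (p : List ℕ → Bool) → count (p ∘ entries) (allVecs m k) ≡ count p (words m k)
count-allVecs m k p = trans (sym (count-map p entries (allVecs m k))) (cong (count p) (entries-allVecs m k))

head-or-0 : List ℕ → ℕ
head-or-0 [] = 0
head-or-0 (x ∷ _) = x

tail-or-[] : List ℕ → List ℕ
tail-or-[] [] = []
tail-or-[] (_ ∷ l) = l

words-unique : ∀ m k → Unique (words m k)
words-unique zero k = [] ∷ []
words-unique (suc m) k =
  Unique-concatMap (λ l → map (_∷ l) (upTo k)) (words m k) (words-unique m k)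
    (λ _ → Unique.map⁺ (cong head-or-0) (Unique.upTo⁺ k))
    (λ {l} {l'} _ _ z∈ z∈' → let (_ , _ , e) = ∈-map⁻ (_∷ l) z∈ ; (_ , _ , e') = ∈-map⁻ (_∷ l') z∈' in
                           cong tail-or-[] (trans (sym e) e'))

∈-words⁻ : ∀ m k {l} → l ∈ words m k → length l ≡ m × All (_< k) l
∈-words⁻ zero k (here refl) = refl , []
∈-words⁻ (suc m) k l∈ with ∈-concatMap-elim (λ l → map (_∷ l) (upTo k)) (words m k) l∈
... | l' , l'∈ , x∷l'∈ with ∈-map⁻ (_∷ l') x∷l'∈
... | x , x∈ , refl = let (len , bound) = ∈-words⁻ m k l'∈ in cong suc len , ∈-upTo⁻ x∈ ∷ bound

∈-words⁺ : ∀ m k {l} → length l ≡ m → All (_< k) l → l ∈ words m k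
∈-words⁺ zero k {[]} refl [] = here refl
∈-words⁺ (suc m) k {x ∷ l} len (x<k ∷ bound) =
  ∈-concatMap-intro (λ l → map (_∷ l) (upTo k)) (∈-words⁺ m k (suc-injective len) bound) (∈-map⁺ (_∷ l) (∈-upTo⁺ x<k))

-- Reading a list as a function (0 past the end).
nth : List ℕ → ℕ → ℕ
nth [] t = 0
nth (x ∷ l) zero = x
nth (x ∷ l) (suc t) = nth l t

lookup-nth : ∀ {m k} (v : Vec (Fin k) m) (t : Fin m) → toℕ (lookup v t) ≡ nth (entries v) (toℕ t)
lookup-nth (x ∷ᵥ v) fzero = refl
lookup-nth (x ∷ᵥ v) (fsuc t) = lookup-nth v t

allB-sound : {A : Set} (p : A → Bool) (xs : List A) → allB p xs ≡ true → ∀ {x} → x ∈ xs → p x ≡ true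
allB-sound p (x ∷ xs) all (here refl) = proj₁ (∧-split {p x} all)
allB-sound p (x ∷ xs) all (there x∈) = allB-sound p xs (proj₂ (∧-split {p x} all)) x∈

allB-complete : {A : Set} (p : A → Bool) (xs : List A) → (∀ {x} → x ∈ xs → p x ≡ true) → allB p xs ≡ true
allB-complete p [] h = refl
allB-complete p (x ∷ xs) h = ∧-intro (h (here refl)) (allB-complete p xs (h ∘ there))

allB-map : {A B : Set} (p : B → Bool) (f : A → B) (xs : List A) → allB p (map f xs) ≡ allB (p ∘ f) xs
allB-map p f [] = refl
allB-map p f (x ∷ xs) = cong (p (f x) ∧_) (allB-map p f xs)

allB-cong : {A : Set} {p q : A → Bool} (xs : List A) → (∀ x → p x ≡ q x) → allB p xs ≡ allB q xs
allB-cong [] h = refl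
allB-cong (x ∷ xs) h = cong₂ _∧_ (h x) (allB-cong xs h)

distinct-Unique : ∀ l → distinct l ≡ true → Unique l
distinct-Unique [] _ = []
distinct-Unique (x ∷ l) d =
  let (x∉ , rest) = ∧-split {allB (λ y → not (x ≡ᵇ y)) l} d in
  All-∈ l (λ {y} y∈ x≡y → differ y (not-true (allB-sound _ l x∉ y∈)) x≡y) ∷ distinct-Unique l rest
  where differ : ∀ y → (x ≡ᵇ y) ≡ false → ¬ (x ≡ y)
        differ y ne x≡y with trans (sym ne) (≡ᵇ-true x≡y)
        ... | ()

Unique-distinct : ∀ l → Unique l → distinct l ≡ true
Unique-distinct [] _ = refl
Unique-distinct (x ∷ l) (x∉ ∷ u) =
  ∧-intro (allB-complete _ l (λ y∈ → cong not (≡ᵇ-false _ _ (∈-All x∉ y∈)))) (Unique-distinct l u)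

insert : ℕ → ℕ → List ℕ → List ℕ
insert zero x l = x ∷ l
insert (suc g) x [] = x ∷ []
insert (suc g) x (y ∷ l) = y ∷ insert g x l

length-insert : ∀ g x l → length (insert g x l) ≡ suc (length l)
length-insert zero x l = refl
length-insert (suc g) x [] = refl
length-insert (suc g) x (y ∷ l) = cong suc (length-insert g x l)

∈-insert⁻ : ∀ g x l {z} → z ∈ insert g x l → z ≡ x ⊎ z ∈ l
∈-insert⁻ zero x l (here e) = inj₁ e
∈-insert⁻ zero x l (there z∈) = inj₂ z∈
∈-insert⁻ (suc g) x [] (here e) = inj₁ e
∈-insert⁻ (suc g) x (y ∷ l) (here e) = inj₂ (here e)
∈-insert⁻ (suc g) x (y ∷ l) (there z∈) with ∈-insert⁻ g x l z∈
... | inj₁ e = inj₁ e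
... | inj₂ z∈l = inj₂ (there z∈l)

All-insert : ∀ {P : ℕ → Set} g x l → P x → All P l → All P (insert g x l)
All-insert {P} g x l px pl = All-∈ (insert g x l) (λ z∈ → either (∈-insert⁻ g x l z∈))
  where either : ∀ {z} → z ≡ x ⊎ z ∈ l → P z
        either (inj₁ refl) = px
        either (inj₂ z∈) = ∈-All pl z∈

Fresh : ℕ → List ℕ → Set
Fresh x l = All (λ y → ¬ (x ≡ y)) l

Unique-insert : ∀ g x l → Fresh x l → Unique l → Unique (insert g x l)
Unique-insert zero x l x∉ u = x∉ ∷ u
Unique-insert (suc g) x [] x∉ u = [] ∷ []
Unique-insert (suc g) x (y ∷ l) (x≢y ∷ x∉) (y∉ ∷ u) = All-insert g x l (λ y≡x → x≢y (sym y≡x)) y∉ ∷ Unique-insert g x l x∉ u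

insert-split : ∀ as bs x → insert (length as) x (as ++ bs) ≡ as ++ x ∷ bs
insert-split [] bs x = refl
insert-split (a ∷ as) bs x = cong (a ∷_) (insert-split as bs x)

delete : ℕ → List ℕ → List ℕ
delete x [] = []
delete x (y ∷ l) = if x ≡ᵇ y then l else y ∷ delete x l

delete-insert : ∀ g x l → Fresh x l → delete x (insert g x l) ≡ l
delete-insert zero x l _ rewrite ≡ᵇ-refl x = refl
delete-insert (suc g) x [] _ rewrite ≡ᵇ-refl x = refl
delete-insert (suc g) x (y ∷ l) (x≢y ∷ x∉) rewrite ≡ᵇ-false x y x≢y = cong (y ∷_) (delete-insert g x l x∉)

insert-injective : ∀ l x g₁ g₂ → Fresh x l → g₁ ≤ length l → g₂ ≤ length l → insert g₁ x l ≡ insert g₂ x l → g₁ ≡ g₂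
insert-injective l x zero zero _ _ _ _ = refl
insert-injective (y ∷ l) x zero (suc g₂) (x≢y ∷ _) _ _ e = ⊥-elim (x≢y (cong head-or-0 e))
insert-injective (y ∷ l) x (suc g₁) zero (x≢y ∷ _) _ _ e = ⊥-elim (x≢y (sym (cong head-or-0 e)))
insert-injective (y ∷ l) x (suc g₁) (suc g₂) (_ ∷ x∉) (s≤s g₁≤) (s≤s g₂≤) e =
  cong suc (insert-injective l x g₁ g₂ x∉ g₁≤ g₂≤ (cong tail-or-[] e))

perms : ℕ → List (List ℕ)
perms zero = [] ∷ []
perms (suc n) = concatMap (λ l → map (λ g → insert g n l) (upTo (suc n))) (perms n)

IsPerm : ℕ → List ℕ → Set
IsPerm n l = length l ≡ n × All (_< n) l × Unique l

bounded-fresh : ∀ {n l} → All (_< n) l → Fresh n l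
bounded-fresh [] = []
bounded-fresh (y<n ∷ bound) = (λ n≡y → <-irrefl (sym n≡y) y<n) ∷ bounded-fresh bound

∈-perms⁻ : ∀ n {l} → l ∈ perms n → IsPerm n l
∈-perms⁻ zero (here refl) = refl , [] , []
∈-perms⁻ (suc n) l∈ with ∈-concatMap-elim (λ l → map (λ g → insert g n l) (upTo (suc n))) (perms n) l∈
... | l , l∈perms , l∈ins with ∈-map⁻ (λ g → insert g n l) {xs = upTo (suc n)} l∈ins
... | g , _ , refl with ∈-perms⁻ n l∈perms
... | len , bound , u =
  trans (length-insert g n l) (cong suc len) ,
  All-insert g n l ≤-refl (All-∈ l (λ z∈ → m<n⇒m<1+n (∈-All bound z∈))) ,
  Unique-insert g n l (bounded-fresh bound) u

max-∈ : ∀ n l → Unique l → All (_< suc n) l → length l ≡ suc n → n ∈ l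
max-∈ n l u bound len with n ∈? l
... | yes n∈ = n∈
... | no n∉ = ⊥-elim (<-irrefl refl (≤-trans (≤-reflexive (sym len)) (≤-trans (length-⊆ l u below-n) (≤-reflexive (length-upTo n)))))
  where below-n : ∀ {x} → x ∈ l → x ∈ upTo n
        below-n {x} x∈ = ∈-upTo⁺ (≤∧≢⇒< (≤-pred (∈-All bound x∈)) (λ x≡n → n∉ (subst (_∈ l) x≡n x∈)))

All-remove : ∀ {P : ℕ → Set} as bs x → All P (as ++ x ∷ bs) → All P (as ++ bs) × P x
All-remove [] bs x (px ∷ pbs) = pbs , px
All-remove (a ∷ as) bs x (pa ∷ rest) = let (pas , px) = All-remove as bs x rest in (pa ∷ pas) , px

Unique-remove : ∀ as bs x → Unique (as ++ x ∷ bs) → Unique (as ++ bs) × Fresh x (as ++ bs)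
Unique-remove [] bs x (x∉ ∷ u) = u , x∉
Unique-remove (a ∷ as) bs x (a∉ ∷ u) =
  let (u' , x∉) = Unique-remove as bs x u ; (a∉' , a≢x) = All-remove as bs x a∉ in
  (a∉' ∷ u') , ((λ x≡a → a≢x (sym x≡a)) ∷ x∉)

∈-perms⁺ : ∀ n {l} → IsPerm n l → l ∈ perms n
∈-perms⁺ zero {[]} _ = here refl
∈-perms⁺ (suc n) {l} (len , bound , u) with ∈-∃++ (max-∈ n l u bound len)
... | as , bs , refl =
  ∈-concatMap-intro (λ l → map (λ g → insert g n l) (upTo (suc n))) (∈-perms⁺ n (len' , bound' , proj₁ removed))
    (subst (_∈ map (λ g → insert g n l') (upTo (suc n))) (insert-split as bs n) (∈-map⁺ (λ g → insert g n l') (∈-upTo⁺ (s≤s gap≤n))))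
  where
  l' = as ++ bs
  removed = Unique-remove as bs n u
  len' : length l' ≡ n
  len' = trans (length-++ as) (suc-injective (trans (sym (+-suc (length as) (length bs))) (trans (sym (length-++ as)) len)))
  bound' : All (_< n) l'
  bound' = All-∈ l' (λ z∈ → ≤∧≢⇒< (≤-pred (∈-All (proj₁ (All-remove as bs n bound)) z∈)) (λ z≡n → ∈-All (proj₂ removed) z∈ (sym z≡n)))
  gap≤n : length as ≤ n
  gap≤n = ≤-trans (m≤m+n (length as) (length bs)) (≤-reflexive (trans (sym (length-++ as)) len'))

-- Different permutations or gaps give different insertions; delete undoes insert.
perms-unique : ∀ n → Unique (perms n)
perms-unique zero = [] ∷ []
perms-unique (suc n) = Unique-concatMap (λ l → map (λ g → insert g n l) (upTo (suc n))) (perms n) (perms-unique n) insertions-unique disjoint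
  where
  insertions-unique : ∀ {l} → l ∈ perms n → Unique (map (λ g → insert g n l) (upTo (suc n)))
  insertions-unique {l} l∈ =
    let (len , bound , _) = ∈-perms⁻ n l∈
        gap≤ : ∀ {g} → g ∈ upTo (suc n) → g ≤ length l
        gap≤ g∈ = ≤-trans (≤-pred (∈-upTo⁻ g∈)) (≤-reflexive (sym len))
    in Unique-map-on (λ g → insert g n l) (upTo (suc n)) (Unique.upTo⁺ (suc n))
         (λ g₁∈ g₂∈ → insert-injective l n _ _ (bounded-fresh bound) (gap≤ g₁∈) (gap≤ g₂∈))
  disjoint : ∀ {l l' z} → l ∈ perms n → l' ∈ perms n → z ∈ map (λ g → insert g n l) (upTo (suc n)) →
             z ∈ map (λ g → insert g n l') (upTo (suc n)) → l ≡ l'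
  disjoint {l} {l'} l∈ l'∈ z∈ z∈' =
    let (g₁ , _ , e₁) = ∈-map⁻ (λ g → insert g n l) {xs = upTo (suc n)} z∈
        (g₂ , _ , e₂) = ∈-map⁻ (λ g → insert g n l') {xs = upTo (suc n)} z∈'
        (_ , bound , _) = ∈-perms⁻ n l∈ ; (_ , bound' , _) = ∈-perms⁻ n l'∈
    in trans (sym (delete-insert g₁ n l (bounded-fresh bound)))
             (trans (cong (delete n) (trans (sym e₁) e₂)) (delete-insert g₂ n l' (bounded-fresh bound')))

P-perms : ∀ n k → P n k ≡ count (λ l → peaks l ≡ᵇ k) (perms n)
P-perms n k =
  trans (count-allVecs n n (λ l → distinct l ∧ (peaks l ≡ᵇ k)))
        (count-≡ _ _ (words n n) (perms n) (words-unique n n) (perms-unique n) word⇒perm perm⇒word)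
  where
  word⇒perm : ∀ {l} → l ∈ words n n → (distinct l ∧ (peaks l ≡ᵇ k)) ≡ true → l ∈ perms n × (peaks l ≡ᵇ k) ≡ true
  word⇒perm {l} l∈ test = let (d , pk) = ∧-split {distinct l} test ; (len , bound) = ∈-words⁻ n n l∈ in
    ∈-perms⁺ n (len , bound , distinct-Unique l d) , pk
  perm⇒word : ∀ {l} → l ∈ perms n → (peaks l ≡ᵇ k) ≡ true → l ∈ words n n × (distinct l ∧ (peaks l ≡ᵇ k)) ≡ true
  perm⇒word {l} l∈ pk = let (len , bound , u) = ∈-perms⁻ n l∈ in ∈-words⁺ n n len bound , ∧-intro (Unique-distinct l u) pk

peakAfter : ℕ → List ℕ → ℕ
peakAfter y [] = 0
peakAfter y (a ∷ []) = 0
peakAfter y (a ∷ c ∷ r) = ind ((y <ᵇ a) ∧ (c <ᵇ a))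

peaks-∷ : ∀ y M → peaks (y ∷ M) ≡ peakAfter y M + peaks M
peaks-∷ y [] = refl
peaks-∷ y (a ∷ []) = refl
peaks-∷ y (a ∷ c ∷ r) = refl

-- isPeak l i: whether position i + 1 of l is a peak.
isPeak : List ℕ → ℕ → ℕ
isPeak [] i = 0
isPeak (y ∷ r) zero = peakAfter y r
isPeak (a ∷ r) (suc i) = isPeak r i

-- isPeak l (g ∸ 1) for g ≥ 1: whether position g of l is a peak.
isPeakAt : List ℕ → ℕ → ℕ
isPeakAt l zero = 0
isPeakAt l (suc i) = isPeak l i

peaks-isPeak : ∀ l → peaks l ≡ sumTo (length l ∸ 2) (isPeak l)
peaks-isPeak [] = refl
peaks-isPeak (a ∷ []) = refl
peaks-isPeak (a ∷ c ∷ []) = refl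
peaks-isPeak (a ∷ c ∷ d ∷ r) =
  trans (cong (peakAfter a (c ∷ d ∷ r) +_) (peaks-isPeak (c ∷ d ∷ r))) (sym (sumTo-head (length r) (isPeak (a ∷ c ∷ d ∷ r))))

isPeak-end : ∀ l i → length l ≤ suc (suc i) → isPeak l i ≡ 0
isPeak-end [] i _ = refl
isPeak-end (a ∷ []) zero _ = refl
isPeak-end (a ∷ c ∷ []) zero _ = refl
isPeak-end (a ∷ c ∷ d ∷ r) zero (s≤s (s≤s ()))
isPeak-end (a ∷ r) (suc i) (s≤s len≤) = isPeak-end r i len≤

sum-isPeak : ∀ l len' → length l ≡ suc len' → sumTo len' (isPeak l) ≡ peaks l
sum-isPeak l zero len = sym (trans (peaks-isPeak l) (cong (λ L → sumTo (L ∸ 2) (isPeak l)) len))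
sum-isPeak l (suc n) len =
  trans (cong (sumTo n (isPeak l) +_) (isPeak-end l n (≤-reflexive len)))
        (trans (+-identityʳ _) (sym (trans (peaks-isPeak l) (cong (λ L → sumTo (L ∸ 2) (isPeak l)) len))))

sum-isPeakAt : ∀ l len' → length l ≡ suc len' → sumTo len' (isPeakAt l) ≡ peaks l
sum-isPeakAt l zero len = sym (trans (peaks-isPeak l) (cong (λ L → sumTo (L ∸ 2) (isPeak l)) len))
sum-isPeakAt l (suc n) len = trans (sumTo-head n (isPeakAt l)) (sym (trans (peaks-isPeak l) (cong (λ L → sumTo (L ∸ 2) (isPeak l)) len)))

peakAfter≤1 : ∀ y l → peakAfter y l ≤ 1
peakAfter≤1 y [] = z≤n
peakAfter≤1 y (a ∷ []) = z≤n
peakAfter≤1 y (a ∷ c ∷ r) = ind≤1 _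

adjacent-peaks : ∀ l i → isPeak l i + isPeak l (suc i) ≤ 1
adjacent-peaks [] zero = z≤n
adjacent-peaks (a ∷ []) zero = z≤n
adjacent-peaks (a ∷ c ∷ []) zero = z≤n
adjacent-peaks (a ∷ c ∷ d ∷ []) zero = ≤-trans (≤-reflexive (+-identityʳ _)) (ind≤1 _)
adjacent-peaks (a ∷ c ∷ d ∷ e ∷ r) zero with d <ᵇ c in d<c | c <ᵇ d in c<d
... | true | true = ⊥-elim (<-asym (<ᵇ-sound d c d<c) (<ᵇ-sound c d c<d))
... | false | _ rewrite ∧-zeroʳ (a <ᵇ c) = ind≤1 _
... | true | false = ≤-trans (≤-reflexive (+-identityʳ _)) (ind≤1 _)
adjacent-peaks [] (suc i) = z≤n
adjacent-peaks (a ∷ r) (suc i) = adjacent-peaks r i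

-- The gap g of l (between positions g and g + 1) touches at most one peak.
gap-peaks≤1 : ∀ l g → isPeakAt l g + isPeak l g ≤ 1
gap-peaks≤1 [] zero = z≤n
gap-peaks≤1 (y ∷ r) zero = peakAfter≤1 y r
gap-peaks≤1 l (suc i) = adjacent-peaks l i

peakAfter-below : ∀ x c r → c < x → peakAfter x (c ∷ r) ≡ 0
peakAfter-below x c [] _ = refl
peakAfter-below x c (d ∷ r) c<x rewrite <ᵇ-false x c (<-asym c<x) = refl

peaks-insert-front : ∀ x l → All (_< x) l → peaks (x ∷ l) ≡ peaks l
peaks-insert-front x [] _ = refl
peaks-insert-front x (c ∷ r) (c<x ∷ _) = trans (peaks-∷ x (c ∷ r)) (cong (_+ peaks (c ∷ r)) (peakAfter-below x c r c<x))

peaks-insert-back : ∀ x l → All (_< x) l → peaks (insert (length l) x l) ≡ peaks l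
peaks-insert-back x [] _ = refl
peaks-insert-back x (y ∷ r) (_ ∷ below) =
  trans (peaks-∷ y (insert (length r) x r)) (trans (cong₂ _+_ (last-gap r below) (peaks-insert-back x r below)) (sym (peaks-∷ y r)))
  where
  last-gap : ∀ r → All (_< x) r → peakAfter y (insert (length r) x r) ≡ peakAfter y r
  last-gap [] _ = refl
  last-gap (a ∷ []) (a<x ∷ _) rewrite <ᵇ-false x a (<-asym a<x) | ∧-zeroʳ (y <ᵇ a) = refl
  last-gap (a ∷ c ∷ r) _ = refl

-- In an interior gap, x becomes a new peak and destroys the peak (if any)
-- adjacent to the gap.
peaks-insert-interior : ∀ l g x → All (_< x) l → suc g < length l →
  peaks (insert (suc g) x l) + isPeakAt l g + isPeak l g ≡ suc (peaks l)
peaks-insert-interior (y ∷ []) g x _ (s≤s ())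
peaks-insert-interior (y ∷ c ∷ r) zero x (y<x ∷ c<x ∷ _) _ rewrite <ᵇ-true y<x | <ᵇ-true c<x =
  trans (cong (λ u → 1 + u + 0 + peakAfter y (c ∷ r)) (trans (peaks-∷ x (c ∷ r)) (cong (_+ peaks (c ∷ r)) (peakAfter-below x c r c<x))))
        (trans (shuffle (peaks (c ∷ r)) (peakAfter y (c ∷ r))) (cong suc (sym (peaks-∷ y (c ∷ r)))))
  where shuffle : ∀ p h → 1 + (0 + p) + 0 + h ≡ suc (h + p)
        shuffle = solve-∀
peaks-insert-interior (y ∷ c ∷ r) (suc zero) x (y<x ∷ c<x ∷ below) (s≤s gap<) rewrite <ᵇ-false x c (<-asym c<x) | ∧-zeroʳ (y <ᵇ c) =
  trans (shuffle (peaks (c ∷ x ∷ r)) (peakAfter y (c ∷ r)) (peakAfter c r) (peaks (c ∷ r)) ih) (cong suc (sym (peaks-∷ y (c ∷ r))))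
  where
  ih : peaks (c ∷ x ∷ r) + 0 + peakAfter c r ≡ suc (peaks (c ∷ r))
  ih = peaks-insert-interior (c ∷ r) zero x (c<x ∷ below) gap<
  shuffle : ∀ q h s p → q + 0 + s ≡ suc p → q + h + s ≡ suc (h + p)
  shuffle q h s p e = trans (reorder q h s) (trans (cong (h +_) e) (+-suc h p))
    where reorder : ∀ q h s → q + h + s ≡ h + (q + 0 + s)
          reorder = solve-∀
peaks-insert-interior (y ∷ c ∷ []) (suc (suc g)) x _ (s≤s (s≤s ()))
peaks-insert-interior (y ∷ c ∷ d ∷ r) (suc (suc g)) x (_ ∷ below) (s≤s gap<) =
  shuffle (ind ((y <ᵇ c) ∧ (d <ᵇ c))) (peaks (c ∷ d ∷ insert g x r)) (isPeak (c ∷ d ∷ r) g) (isPeak (c ∷ d ∷ r) (suc g)) (peaks (c ∷ d ∷ r))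
    (peaks-insert-interior (c ∷ d ∷ r) (suc g) x below gap<)
  where
  shuffle : ∀ i q s t p → q + s + t ≡ suc p → i + q + s + t ≡ suc (i + p)
  shuffle i q s t p e = trans (reorder i q s t) (trans (cong (i +_) e) (+-suc i p))
    where reorder : ∀ i q s t → i + q + s + t ≡ i + (q + s + t)
          reorder = solve-∀

-- Each of the p peaks of l is adjacent to exactly two interior gaps.
peak-adjacent-gaps : ∀ l len' → length l ≡ suc len' → sumTo len' (λ g → isPeakAt l g + isPeak l g) ≡ peaks l + peaks l
peak-adjacent-gaps l len' len = trans (sumTo-+ len' (isPeakAt l) (isPeak l)) (cong₂ _+_ (sum-isPeakAt l len' len) (sum-isPeak l len' len))

-- Of the len' + 2 gaps of l (length len' + 1, p peaks), inserting a new
-- maximum keeps p peaks at 2p + 2 gaps (the ends and the gaps next to a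
-- peak) and produces p + 1 peaks at the remaining len' ∸ 2p gaps.
insertions-by-peaks : ∀ l x K → All (_< x) l → ∀ len' → length l ≡ suc len' →
  sumTo (suc (length l)) (λ g → ind (peaks (insert g x l) ≡ᵇ K)) ≡
  ind (peaks l ≡ᵇ K) * (2 * peaks l + 2) + ind (suc (peaks l) ≡ᵇ K) * (len' ∸ 2 * peaks l)
insertions-by-peaks l x K below len' len rewrite len = begin
  sumTo (suc (suc len')) f
    ≡⟨ cong (_+ f (suc len')) (sumTo-head len' f) ⟩
  f 0 + sumTo len' (f ∘ suc) + f (suc len')
    ≡⟨ cong₂ (λ u v → u + sumTo len' (f ∘ suc) + v) (cong (λ v → ind (v ≡ᵇ K)) (peaks-insert-front x l below))
         (cong (λ v → ind (v ≡ᵇ K)) (trans (cong (λ L → peaks (insert L x l)) (sym len)) (peaks-insert-back x l below))) ⟩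
  A + sumTo len' (f ∘ suc) + A
    ≡⟨ cong (λ u → A + u + A) (sumTo-cong len' interior) ⟩
  A + sumTo len' (λ g → s g * A + (1 ∸ s g) * B) + A
    ≡⟨ cong (λ u → A + u + A) (trans (sumTo-+ len' (λ g → s g * A) (λ g → (1 ∸ s g) * B))
                                     (cong₂ _+_ (sumTo-*ʳ len' A s) (sumTo-*ʳ len' B (λ g → 1 ∸ s g)))) ⟩
  A + (A * sumTo len' s + B * sumTo len' (λ g → 1 ∸ s g)) + A
    ≡⟨ cong₂ (λ u v → A + (A * u + B * v) + A) (peak-adjacent-gaps l len' len)
         (trans (sumTo-complement len' s (λ g _ → gap-peaks≤1 l g)) (cong (len' ∸_) (peak-adjacent-gaps l len' len))) ⟩
  A + (A * (p + p) + B * (len' ∸ (p + p))) + A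
    ≡⟨ collect A B p (len' ∸ (p + p)) ⟩
  A * (2 * p + 2) + B * (len' ∸ (p + p))
    ≡⟨ cong (λ u → A * (2 * p + 2) + B * (len' ∸ (p + u))) (sym (+-identityʳ p)) ⟩
  A * (2 * p + 2) + B * (len' ∸ 2 * p) ∎
  where
  open ≡-Reasoning
  f : ℕ → ℕ
  f g = ind (peaks (insert g x l) ≡ᵇ K)
  p = peaks l
  A = ind (p ≡ᵇ K)
  B = ind (suc p ≡ᵇ K)
  s : ℕ → ℕ
  s g = isPeakAt l g + isPeak l g
  interior : ∀ g → g < len' → f (suc g) ≡ s g * A + (1 ∸ s g) * B
  interior g g< = ind-shift (peaks (insert (suc g) x l)) (s g) p K
    (trans (sym (+-assoc (peaks (insert (suc g) x l)) (isPeakAt l g) (isPeak l g))) (peaks-insert-interior l g x below (subst (suc g <_) (sym len) (s≤s g<))))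
    (gap-peaks≤1 l g)
  collect : ∀ A B p X → A + (A * (p + p) + B * X) + A ≡ A * (2 * p + 2) + B * X
  collect = solve-∀

-- Recurrence for P: every permutation of [0, n + 2) arises from exactly
-- one permutation of [0, n + 1) by inserting n + 1.
P-by-insertion : ∀ n K → P (suc (suc n)) K ≡
  sumL (λ l → ind (peaks l ≡ᵇ K) * (2 * peaks l + 2) + ind (suc (peaks l) ≡ᵇ K) * (n ∸ 2 * peaks l)) (perms (suc n))
P-by-insertion n K =
  trans (P-perms (suc (suc n)) K) (trans (count-concatMap (λ l → peaks l ≡ᵇ K) insertions (perms (suc n))) (sumL-cong (perms (suc n)) per-perm))
  where
  insertions : List ℕ → List (List ℕ)
  insertions l = map (λ g → insert g (suc n) l) (upTo (suc (suc n)))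
  per-perm : ∀ {l} → l ∈ perms (suc n) → count (λ l → peaks l ≡ᵇ K) (insertions l) ≡
    ind (peaks l ≡ᵇ K) * (2 * peaks l + 2) + ind (suc (peaks l) ≡ᵇ K) * (n ∸ 2 * peaks l)
  per-perm {l} l∈ with ∈-perms⁻ (suc n) l∈
  ... | len , below , _ =
    trans (count-map (λ l → peaks l ≡ᵇ K) (λ g → insert g (suc n) l) (upTo (suc (suc n))))
    (trans (count-upTo (λ g → peaks (insert g (suc n) l) ≡ᵇ K) (suc (suc n)))
    (trans (cong (λ L → sumTo (suc L) (λ g → ind (peaks (insert g (suc n) l) ≡ᵇ K))) (sym len))
           (insertions-by-peaks l (suc n) K below n len)))

sum-perms-peaks : ∀ n K c → sumL (λ l → c * ind (peaks l ≡ᵇ K)) (perms n) ≡ c * P n K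
sum-perms-peaks n K c =
  trans (sumL-* c (λ l → ind (peaks l ≡ᵇ K)) (perms n))
        (cong (c *_) (sym (trans (P-perms n K) (count-sumL (λ l → peaks l ≡ᵇ K) (perms n)))))

P-rec₀ : ∀ n → 1 ≤ n → P (suc n) 0 ≡ 2 * P n 0
P-rec₀ (suc n) _ =
  trans (P-by-insertion n 0) (trans (sumL-cong (perms (suc n)) (λ {l} _ → no-peaks (peaks l))) (sum-perms-peaks (suc n) 0 2))
  where no-peaks : ∀ p → ind (p ≡ᵇ 0) * (2 * p + 2) + ind (suc p ≡ᵇ 0) * (n ∸ 2 * p) ≡ 2 * ind (p ≡ᵇ 0)
        no-peaks zero = refl
        no-peaks (suc p) = refl

P-rec : ∀ n → 1 ≤ n → ∀ k → P (suc n) (suc k) ≡ (2 * k + 4) * P n (suc k) + (n ∸ suc (2 * k)) * P n k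
P-rec (suc n) _ k = begin
  P (suc (suc n)) (suc k)
    ≡⟨ P-by-insertion n (suc k) ⟩
  sumL (λ l → ind (peaks l ≡ᵇ suc k) * (2 * peaks l + 2) + ind (suc (peaks l) ≡ᵇ suc k) * (n ∸ 2 * peaks l)) (perms (suc n))
    ≡⟨ sumL-cong (perms (suc n)) (λ {l} _ → at-peaks (peaks l)) ⟩
  sumL (λ l → (2 * k + 4) * ind (peaks l ≡ᵇ suc k) + (n ∸ 2 * k) * ind (peaks l ≡ᵇ k)) (perms (suc n))
    ≡⟨ sumL-+ (λ l → (2 * k + 4) * ind (peaks l ≡ᵇ suc k)) (λ l → (n ∸ 2 * k) * ind (peaks l ≡ᵇ k)) (perms (suc n)) ⟩
  _ ≡⟨ cong₂ _+_ (sum-perms-peaks (suc n) (suc k) (2 * k + 4)) (sum-perms-peaks (suc n) k (n ∸ 2 * k)) ⟩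
  (2 * k + 4) * P (suc n) (suc k) + (n ∸ 2 * k) * P (suc n) k ∎
  where
  open ≡-Reasoning
  at-peaks : ∀ p → ind (p ≡ᵇ suc k) * (2 * p + 2) + ind (suc p ≡ᵇ suc k) * (n ∸ 2 * p) ≡
                   (2 * k + 4) * ind (p ≡ᵇ suc k) + (n ∸ 2 * k) * ind (p ≡ᵇ k)
  at-peaks p = cong₂ _+_
    (trans (δ-subst p (suc k) (λ q → 2 * q + 2)) (trans (*-comm _ (2 * suc k + 2)) (cong (_* ind (p ≡ᵇ suc k)) (factor k))))
    (trans (δ-subst p k (λ q → n ∸ 2 * q)) (*-comm _ (n ∸ 2 * k)))
    where factor : ∀ k → 2 * suc k + 2 ≡ 2 * k + 4
          factor = solve-∀

nth-applyUpTo : ∀ m F t → t < m → nth (applyUpTo F m) t ≡ F t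
nth-applyUpTo (suc m) F zero _ = refl
nth-applyUpTo (suc m) F (suc t) (s≤s t<m) = nth-applyUpTo m (F ∘ suc) t t<m

applyUpTo-nth : ∀ L → L ≡ applyUpTo (nth L) (length L)
applyUpTo-nth [] = refl
applyUpTo-nth (x ∷ L) = cong (x ∷_) (applyUpTo-nth L)

applyUpTo-cong : ∀ m {F G : ℕ → ℕ} → (∀ t → t < m → F t ≡ G t) → applyUpTo F m ≡ applyUpTo G m
applyUpTo-cong zero h = refl
applyUpTo-cong (suc m) h = cong₂ _∷_ (h 0 (s≤s z≤n)) (applyUpTo-cong m (λ t t<m → h (suc t) (s≤s t<m)))

tabulation : ∀ m L F → length L ≡ m → (∀ t → t < m → nth L t ≡ F t) → L ≡ applyUpTo F m
tabulation m L F len agree = trans (applyUpTo-nth L) (trans (cong (applyUpTo (nth L)) len) (applyUpTo-cong m agree))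

All-nth : ∀ {P : ℕ → Set} L → (∀ t → t < length L → P (nth L t)) → All P L
All-nth [] h = []
All-nth (x ∷ L) h = h 0 (s≤s z≤n) ∷ All-nth L (λ t t< → h (suc t) (s≤s t<))

nth-All : ∀ {P : ℕ → Set} {L} → All P L → ∀ t → t < length L → P (nth L t)
nth-All (px ∷ _) zero _ = px
nth-All (_ ∷ pxs) (suc t) (s≤s t<) = nth-All pxs t t<

MatchingFn : ℕ → (ℕ → ℕ) → Set
MatchingFn m f = ∀ t → t < m → f t < m × f (f t) ≡ t × ¬ (f t ≡ t)

Matching : ℕ → List ℕ → Set
Matching m L = length L ≡ m × MatchingFn m (nth L)

tabulate-matching : ∀ m F → MatchingFn m F → Matching m (applyUpTo F m)
tabulate-matching m F match = length-applyUpTo F m , λ t t<m →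
  let (Ft<m , FFt≡t , Ft≢t) = match t t<m ; tab = nth-applyUpTo m F in
  subst (_< m) (sym (tab t t<m)) Ft<m ,
  trans (cong (nth (applyUpTo F m)) (tab t t<m)) (trans (tab (F t) Ft<m) FFt≡t) ,
  (λ e → Ft≢t (trans (sym (tab t t<m)) e))

-- A matching of [0, m + 2) arises from a matching M of [0, m) (on the
-- shifted points 2, 3, …) in one of m + 1 ways: either 0 and 1 form a
-- block, or the block {a, M a} of M is opened into {0, a}, {1, M a}.

pairFirstTwo : List ℕ → ℕ → ℕ
pairFirstTwo M zero = 1
pairFirstTwo M (suc zero) = 0
pairFirstTwo M (suc (suc t)) = suc (suc (nth M t))

pairVia : List ℕ → ℕ → ℕ → ℕ
pairVia M a zero = suc (suc a)
pairVia M a (suc zero) = suc (suc (nth M a))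
pairVia M a (suc (suc t)) = if t ≡ᵇ a then 0 else (if t ≡ᵇ nth M a then 1 else suc (suc (nth M t)))

extensions : ℕ → List ℕ → List (List ℕ)
extensions m M = applyUpTo (pairFirstTwo M) (suc (suc m)) ∷ map (λ a → applyUpTo (pairVia M a) (suc (suc m))) (upTo m)

-- double n = 2n, by a recursion matching that of matchings.
double : ℕ → ℕ
double zero = 0
double (suc n) = suc (suc (double n))

double≡2* : ∀ n → double n ≡ 2 * n
double≡2* zero = refl
double≡2* (suc n) = trans (cong (λ x → suc (suc x)) (double≡2* n)) (sym (lemma n))
  where lemma : ∀ n → 2 * suc n ≡ suc (suc (2 * n))
        lemma = solve-∀

matchings : ℕ → List (List ℕ)
matchings zero = [] ∷ []
matchings (suc n) = concatMap (extensions (double n)) (matchings n)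

pairFirstTwo-matching : ∀ m M → MatchingFn m (nth M) → MatchingFn (suc (suc m)) (pairFirstTwo M)
pairFirstTwo-matching m M match zero _ = s≤s (s≤s z≤n) , refl , (λ ())
pairFirstTwo-matching m M match (suc zero) _ = s≤s z≤n , refl , (λ ())
pairFirstTwo-matching m M match (suc (suc t)) (s≤s (s≤s t<m)) =
  let (Mt<m , MMt≡t , Mt≢t) = match t t<m in
  s≤s (s≤s Mt<m) , cong (λ x → suc (suc x)) MMt≡t , (λ e → Mt≢t (suc-injective (suc-injective e)))

pairVia-matching : ∀ m M a → a < m → MatchingFn m (nth M) → MatchingFn (suc (suc m)) (pairVia M a)
pairVia-matching m M a a<m match zero _ rewrite ≡ᵇ-refl a = s≤s (s≤s a<m) , refl , (λ ())
pairVia-matching m M a a<m match (suc zero) _ rewrite ≡ᵇ-false (nth M a) a (proj₂ (proj₂ (match a a<m))) | ≡ᵇ-refl (nth M a) =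
  s≤s (s≤s (proj₁ (match a a<m))) , refl , (λ e → 0≢1+n (sym (suc-injective e)))
pairVia-matching m M a a<m match (suc (suc t)) (s≤s (s≤s t<m)) with t ≟ a
... | yes refl rewrite ≡ᵇ-refl t = s≤s z≤n , refl , (λ ())
... | no t≢a rewrite ≡ᵇ-false t a t≢a with t ≟ nth M a
...   | yes refl rewrite ≡ᵇ-refl (nth M a) = s≤s (s≤s z≤n) , refl , (λ e → 0≢1+n (suc-injective e))
...   | no t≢c rewrite ≡ᵇ-false t (nth M a) t≢c =
  let (Mt<m , MMt≡t , Mt≢t) = match t t<m in
  s≤s (s≤s Mt<m) , back (λ e → t≢c (trans (sym MMt≡t) (cong (nth M) e))) (λ e → t≢a (trans (sym MMt≡t) (trans (cong (nth M) e) (proj₁ (proj₂ (match a a<m)))))) MMt≡t ,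
  (λ e → Mt≢t (suc-injective (suc-injective e)))
  where
  back : ¬ (nth M t ≡ a) → ¬ (nth M t ≡ nth M a) → nth M (nth M t) ≡ t → pairVia M a (suc (suc (nth M t))) ≡ suc (suc t)
  back Mt≢a Mt≢c MMt≡t rewrite ≡ᵇ-false (nth M t) a Mt≢a | ≡ᵇ-false (nth M t) (nth M a) Mt≢c = cong (λ x → suc (suc x)) MMt≡t

∈-matchings⁻ : ∀ n {L} → L ∈ matchings n → Matching (double n) L
∈-matchings⁻ zero (here refl) = refl , (λ t ())
∈-matchings⁻ (suc n) L∈ with ∈-concatMap-elim (extensions (double n)) (matchings n) L∈
... | M , M∈ , L∈ext with ∈-matchings⁻ n M∈ | L∈ext
... | (_ , match) | here refl = tabulate-matching _ (pairFirstTwo M) (pairFirstTwo-matching (double n) M match)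
... | (_ , match) | there L∈via with ∈-map⁻ (λ a → applyUpTo (pairVia M a) (suc (suc (double n)))) {xs = upTo (double n)} L∈via
... | a , a∈ , refl = tabulate-matching _ (pairVia M a) (pairVia-matching (double n) M a (∈-upTo⁻ a∈) match)

≥2 : ∀ x → ¬ (x ≡ 0) → ¬ (x ≡ 1) → x ≡ suc (suc (x ∸ 2))
≥2 zero x≢0 _ = ⊥-elim (x≢0 refl)
≥2 (suc zero) _ x≢1 = ⊥-elim (x≢1 refl)
≥2 (suc (suc x)) _ _ = refl

shifted< : ∀ {x u m} → x ≡ suc (suc u) → x < suc (suc m) → u < m
shifted< refl (s≤s (s≤s u<m)) = u<m

-- The inverse construction: restrict a matching of [0, m + 2) to [0, m),
-- dropping the block {0, 1} or closing the blocks of 0 and 1 into one.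

dropFirstTwo : List ℕ → ℕ → ℕ
dropFirstTwo L t = nth L (suc (suc t)) ∸ 2

closeFirstTwo : List ℕ → ℕ → ℕ
closeFirstTwo L t = if t ≡ᵇ (nth L 0 ∸ 2) then nth L 1 ∸ 2 else (if t ≡ᵇ (nth L 1 ∸ 2) then nth L 0 ∸ 2 else dropFirstTwo L t)

restrict : ℕ → List ℕ → List ℕ
restrict m L = if nth L 0 ≡ᵇ 1 then applyUpTo (dropFirstTwo L) m else applyUpTo (closeFirstTwo L) m

module Restrict (m : ℕ) (L : List ℕ) (matchL : Matching (suc (suc m)) L) where
  f = nth L
  len = proj₁ matchL
  match = proj₂ matchL

  f-inv : ∀ t → t < suc (suc m) → f (f t) ≡ t
  f-inv t t< = proj₁ (proj₂ (match t t<))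

  f-inj : ∀ x y → x < suc (suc m) → y < suc (suc m) → f x ≡ f y → x ≡ y
  f-inj x y x< y< e = trans (sym (f-inv x x<)) (trans (cong f e) (f-inv y y<))

  0<2+m : 0 < suc (suc m)
  0<2+m = s≤s z≤n
  1<2+m : 1 < suc (suc m)
  1<2+m = s≤s (s≤s z≤n)
  2+<2+m : ∀ {t} → t < m → suc (suc t) < suc (suc m)
  2+<2+m t<m = s≤s (s≤s t<m)

  module Paired (f0≡1 : f 0 ≡ 1) where
    f1≡0 : f 1 ≡ 0
    f1≡0 = trans (cong f (sym f0≡1)) (f-inv 0 0<2+m)

    G : ℕ → ℕ
    G = dropFirstTwo L

    f-shift : ∀ t → t < m → f (suc (suc t)) ≡ suc (suc (G t))
    f-shift t t<m = ≥2 _ (λ e → 0≢1+n (sym (suc-injective (trans (sym (f-inv _ (2+<2+m t<m))) (trans (cong f e) f0≡1)))))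
                         (λ e → 0≢1+n (sym (trans (sym (f-inv _ (2+<2+m t<m))) (trans (cong f e) f1≡0))))

    G-matching : MatchingFn m G
    G-matching t t<m = let (f<2+m , ff≡ , f≢) = match (suc (suc t)) (2+<2+m t<m) in
      shifted< (f-shift t t<m) f<2+m ,
      cong (_∸ 2) (trans (cong f (sym (f-shift t t<m))) ff≡) ,
      (λ e → f≢ (trans (f-shift t t<m) (cong (λ x → suc (suc x)) e)))

    M = applyUpTo G m

    L≡ : L ≡ applyUpTo (pairFirstTwo M) (suc (suc m))
    L≡ = tabulation (suc (suc m)) L (pairFirstTwo M) len agree
      where agree : ∀ t → t < suc (suc m) → f t ≡ pairFirstTwo M t
            agree zero _ = f0≡1
            agree (suc zero) _ = f1≡0
            agree (suc (suc t)) (s≤s (s≤s t<m)) = trans (f-shift t t<m) (cong (λ x → suc (suc x)) (sym (nth-applyUpTo m G t t<m)))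

  -- Case 2: 0 and 1 have partners a + 2 and c + 2; closing the blocks
  -- {0, a + 2} and {1, c + 2} into {a, c} gives a matching of [0, m).
  module Unpaired (f0≢1 : ¬ (f 0 ≡ 1)) where
    a = f 0 ∸ 2
    c = f 1 ∸ 2

    f0≡ : f 0 ≡ suc (suc a)
    f0≡ = ≥2 _ (proj₂ (proj₂ (match 0 0<2+m))) f0≢1
    f1≡ : f 1 ≡ suc (suc c)
    f1≡ = ≥2 _ (λ e → f0≢1 (trans (cong f (sym e)) (f-inv 1 1<2+m))) (proj₂ (proj₂ (match 1 1<2+m)))
    fa≡0 : f (suc (suc a)) ≡ 0
    fa≡0 = trans (cong f (sym f0≡)) (f-inv 0 0<2+m)
    fc≡1 : f (suc (suc c)) ≡ 1
    fc≡1 = trans (cong f (sym f1≡)) (f-inv 1 1<2+m)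

    a<m : a < m
    a<m = shifted< f0≡ (proj₁ (match 0 0<2+m))
    c<m : c < m
    c<m = shifted< f1≡ (proj₁ (match 1 1<2+m))
    a≢c : ¬ (a ≡ c)
    a≢c e = 0≢1+n (f-inj 0 1 0<2+m 1<2+m (trans f0≡ (trans (cong (λ x → suc (suc x)) e) (sym f1≡))))

    G : ℕ → ℕ
    G = closeFirstTwo L

    G-a : G a ≡ c
    G-a rewrite ≡ᵇ-refl a = refl
    G-c : G c ≡ a
    G-c rewrite ≡ᵇ-false c a (a≢c ∘ sym) | ≡ᵇ-refl c = refl
    G-other : ∀ t → ¬ (t ≡ a) → ¬ (t ≡ c) → G t ≡ f (suc (suc t)) ∸ 2
    G-other t t≢a t≢c rewrite ≡ᵇ-false t a t≢a | ≡ᵇ-false t c t≢c = refl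

    -- Points other than a, c have partners other than 0, 1.
    f-shift : ∀ t → t < m → ¬ (t ≡ a) → ¬ (t ≡ c) → f (suc (suc t)) ≡ suc (suc (f (suc (suc t)) ∸ 2))
    f-shift t t<m t≢a t≢c =
      ≥2 _ (λ e → t≢a (suc-injective (suc-injective (trans (sym (f-inv _ (2+<2+m t<m))) (trans (cong f e) f0≡)))))
           (λ e → t≢c (suc-injective (suc-injective (trans (sym (f-inv _ (2+<2+m t<m))) (trans (cong f e) f1≡)))))

    G-matching-other : ∀ t → t < m → ¬ (t ≡ a) → ¬ (t ≡ c) → G t < m × G (G t) ≡ t × ¬ (G t ≡ t)
    G-matching-other t t<m t≢a t≢c =
      subst (_< m) (sym (G-other t t≢a t≢c)) (shifted< eu f<2+m) ,
      trans (cong G (G-other t t≢a t≢c)) (trans (G-other u u≢a u≢c) (cong (_∸ 2) (trans (cong f (sym eu)) ff≡))) ,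
      (λ e → f≢ (trans eu (cong (λ v → suc (suc v)) (trans (sym (G-other t t≢a t≢c)) e))))
      where
      u = f (suc (suc t)) ∸ 2
      eu = f-shift t t<m t≢a t≢c
      fact = match (suc (suc t)) (2+<2+m t<m)
      f<2+m = proj₁ fact
      ff≡ = proj₁ (proj₂ fact)
      f≢ = proj₂ (proj₂ fact)
      u≢a : ¬ (u ≡ a)
      u≢a e = 0≢1+n (sym (f-inj _ 0 (2+<2+m t<m) 0<2+m (trans eu (trans (cong (λ v → suc (suc v)) e) (sym f0≡)))))
      u≢c : ¬ (u ≡ c)
      u≢c e = 0≢1+n (sym (suc-injective (f-inj _ 1 (2+<2+m t<m) 1<2+m (trans eu (trans (cong (λ v → suc (suc v)) e) (sym f1≡))))))

    G-matching : MatchingFn m G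
    G-matching t t<m with t ≟ a
    ... | yes refl = subst (_< m) (sym G-a) c<m , trans (cong G G-a) G-c , (λ e → a≢c (sym (trans (sym G-a) e)))
    ... | no t≢a with t ≟ c
    ...   | yes refl = subst (_< m) (sym G-c) a<m , trans (cong G G-c) G-a , (λ e → a≢c (trans (sym G-c) e))
    ...   | no t≢c = G-matching-other t t<m t≢a t≢c

    M = applyUpTo G m

    Ma≡c : nth M a ≡ c
    Ma≡c = trans (nth-applyUpTo m G a a<m) G-a

    L≡ : L ≡ applyUpTo (pairVia M a) (suc (suc m))
    L≡ = tabulation (suc (suc m)) L (pairVia M a) len agree
      where agree : ∀ t → t < suc (suc m) → f t ≡ pairVia M a t
            agree zero _ = f0≡
            agree (suc zero) _ = trans f1≡ (cong (λ x → suc (suc x)) (sym Ma≡c))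
            agree (suc (suc t)) (s≤s (s≤s t<m)) rewrite Ma≡c with t ≟ a
            ... | yes refl rewrite ≡ᵇ-refl t = fa≡0
            ... | no t≢a with t ≟ c
            ...   | yes refl rewrite ≡ᵇ-false t a t≢a | ≡ᵇ-refl t = fc≡1
            ...   | no t≢c rewrite ≡ᵇ-false t a t≢a | ≡ᵇ-false t c t≢c =
              trans (f-shift t t<m t≢a t≢c) (cong (λ x → suc (suc x)) (sym (trans (nth-applyUpTo m G t t<m) (G-other t t≢a t≢c))))

∈-matchings⁺ : ∀ n L → Matching (double n) L → L ∈ matchings n
∈-matchings⁺ zero [] _ = here refl
∈-matchings⁺ (suc n) L matchL with nth L 0 ≟ 1
... | yes f0≡1 = ∈-concatMap-intro (extensions (double n)) (∈-matchings⁺ n M (tabulate-matching _ G G-matching)) (here L≡)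
  where open Restrict (double n) L matchL
        open Paired f0≡1
... | no f0≢1 = ∈-concatMap-intro (extensions (double n)) (∈-matchings⁺ n M (tabulate-matching _ G G-matching))
    (there (subst (_∈ map (λ a → applyUpTo (pairVia M a) (suc (suc (double n)))) (upTo (double n))) (sym L≡)
                  (∈-map⁺ (λ a → applyUpTo (pairVia M a) (suc (suc (double n)))) (∈-upTo⁺ a<m))))
  where open Restrict (double n) L matchL
        open Unpaired f0≢1

restrict-pairFirstTwo : ∀ m M → length M ≡ m → restrict m (applyUpTo (pairFirstTwo M) (suc (suc m))) ≡ M
restrict-pairFirstTwo m M len =
  sym (tabulation m M _ len (λ t t<m → sym (cong (_∸ 2) (nth-applyUpTo m (pairFirstTwo M ∘ suc ∘ suc) t t<m))))

restrict-pairVia : ∀ m M a → Matching m M → a < m → restrict m (applyUpTo (pairVia M a) (suc (suc m))) ≡ M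
restrict-pairVia m M a (len , match) a<m = sym (tabulation m M _ len (λ t t<m → sym (closes t t<m)))
  where
  L = applyUpTo (pairVia M a) (suc (suc m))
  closes : ∀ t → t < m → closeFirstTwo L t ≡ nth M t
  closes t t<m rewrite nth-applyUpTo m (pairVia M a ∘ suc ∘ suc) t t<m with t ≟ a
  ... | yes refl rewrite ≡ᵇ-refl t = refl
  ... | no t≢a with t ≟ nth M a
  ...   | yes refl rewrite ≡ᵇ-false t a t≢a | ≡ᵇ-refl t = sym (proj₁ (proj₂ (match a a<m)))
  ...   | no t≢c rewrite ≡ᵇ-false t a t≢a | ≡ᵇ-false t (nth M a) t≢c = refl

-- The extensions of one matching are pairwise different: they differ in the partner of 0.
extensions-unique : ∀ m M → Unique (extensions m M)
extensions-unique m M =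
  All-∈ _ (λ L∈ e → let (a , _ , e') = ∈-map⁻ (λ a → applyUpTo (pairVia M a) (suc (suc m))) {xs = upTo m} L∈ in
                    1≢2+ (cong head-or-0 (trans e e')))
  ∷ Unique-map-on (λ a → applyUpTo (pairVia M a) (suc (suc m))) (upTo m) (Unique.upTo⁺ m)
      (λ _ _ e → suc-injective (suc-injective (cong head-or-0 e)))
  where 1≢2+ : ∀ {a} → ¬ (1 ≡ suc (suc a))
        1≢2+ ()

restrict-extension : ∀ n {M L} → M ∈ matchings n → L ∈ extensions (double n) M → restrict (double n) L ≡ M
restrict-extension n {M} M∈ (here refl) = restrict-pairFirstTwo (double n) M (proj₁ (∈-matchings⁻ n M∈))
restrict-extension n {M} M∈ (there L∈) with ∈-map⁻ (λ a → applyUpTo (pairVia M a) (suc (suc (double n)))) {xs = upTo (double n)} L∈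
... | a , a∈ , refl = restrict-pairVia (double n) M a (∈-matchings⁻ n M∈) (∈-upTo⁻ a∈)

-- Extensions of different matchings differ, since restriction recovers the matching.
matchings-unique : ∀ n → Unique (matchings n)
matchings-unique zero = [] ∷ []
matchings-unique (suc n) =
  Unique-concatMap (extensions (double n)) (matchings n) (matchings-unique n) (λ {M} _ → extensions-unique (double n) M)
    (λ M∈ M'∈ L∈ L∈' → trans (sym (restrict-extension n M∈ L∈)) (restrict-extension n M'∈ L∈'))

isMatchingB : ℕ → List ℕ → Bool
isMatchingB m L = allB (λ t → (nth L (nth L t) ≡ᵇ t) ∧ not (nth L t ≡ᵇ t)) (upTo m)

-- Number of blocks {t, L t} with t < L t and t even (odd in 1-based terms).
oddBlocksL : ℕ → List ℕ → ℕ
oddBlocksL m L = count (λ t → (t <ᵇ nth L t) ∧ (t % 2 ≡ᵇ 0)) (upTo m)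

isFPFInvolution-entries : ∀ {m} (f : Vec (Fin m) m) → isFPFInvolution f ≡ isMatchingB m (entries f)
isFPFInvolution-entries {m} f =
  trans (allB-cong (allFin m) on-index) (trans (sym (allB-map test toℕ (allFin m))) (cong (allB test) (allFin-toℕ m)))
  where
  L = entries f
  test : ℕ → Bool
  test t = (nth L (nth L t) ≡ᵇ t) ∧ not (nth L t ≡ᵇ t)
  on-index : ∀ t → ((toℕ (lookup f (lookup f t)) ≡ᵇ toℕ t) ∧ not (toℕ (lookup f t) ≡ᵇ toℕ t)) ≡ test (toℕ t)
  on-index t rewrite lookup-nth f (lookup f t) | lookup-nth f t = refl

oddBlocks-entries : ∀ {m} (f : Vec (Fin m) m) → oddBlocks f ≡ oddBlocksL m (entries f)
oddBlocks-entries {m} f =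
  trans (count-cong (allFin m) on-index) (trans (sym (count-map test toℕ (allFin m))) (cong (count test) (allFin-toℕ m)))
  where
  L = entries f
  test : ℕ → Bool
  test t = (t <ᵇ nth L t) ∧ (t % 2 ≡ᵇ 0)
  on-index : ∀ t → ((toℕ t <ᵇ toℕ (lookup f t)) ∧ (toℕ t % 2 ≡ᵇ 0)) ≡ test (toℕ t)
  on-index t rewrite lookup-nth f t = refl

-- The boolean test is the proposition MatchingFn, apart from the range condition.
isMatchingB-sound : ∀ m L → isMatchingB m L ≡ true → ∀ t → t < m → nth L (nth L t) ≡ t × ¬ (nth L t ≡ t)
isMatchingB-sound m L ok t t<m =
  let (inv , no-fix) = ∧-split {nth L (nth L t) ≡ᵇ t} (allB-sound _ (upTo m) ok (∈-upTo⁺ t<m)) in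
  ≡ᵇ-sound _ _ inv , (λ e → no-fix≢ (not-true no-fix) e)
  where no-fix≢ : (nth L t ≡ᵇ t) ≡ false → ¬ (nth L t ≡ t)
        no-fix≢ ne e with trans (sym ne) (≡ᵇ-true e)
        ... | ()

isMatchingB-complete : ∀ m L → (∀ t → t < m → nth L (nth L t) ≡ t × ¬ (nth L t ≡ t)) → isMatchingB m L ≡ true
isMatchingB-complete m L h =
  allB-complete _ (upTo m) (λ t∈ → let (inv , no-fix) = h _ (∈-upTo⁻ t∈) in ∧-intro (≡ᵇ-true inv) (cong not (≡ᵇ-false _ _ no-fix)))

N-matchings : ∀ n k → N n k ≡ count (λ L → oddBlocksL (double n) L ≡ᵇ k) (matchings n)
N-matchings n k =
  trans (count-cong (allVecs (2 * n) (2 * n)) (λ f → cong₂ (λ u v → u ∧ (v ≡ᵇ k)) (isFPFInvolution-entries f) (oddBlocks-entries f)))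
  (trans (count-allVecs (2 * n) (2 * n) (λ L → isMatchingB (2 * n) L ∧ (oddBlocksL (2 * n) L ≡ᵇ k)))
  (trans (cong (λ m → count (λ L → isMatchingB m L ∧ (oddBlocksL m L ≡ᵇ k)) (words m m)) (sym (double≡2* n)))
         (count-≡ _ _ (words m m) (matchings n) (words-unique m m) (matchings-unique n) word⇒matching matching⇒word)))
  where
  m = double n
  word⇒matching : ∀ {L} → L ∈ words m m → (isMatchingB m L ∧ (oddBlocksL m L ≡ᵇ k)) ≡ true →
    L ∈ matchings n × (oddBlocksL m L ≡ᵇ k) ≡ true
  word⇒matching {L} L∈ test = let (ok , odd) = ∧-split {isMatchingB m L} test ; (len , bound) = ∈-words⁻ m m L∈ in
    ∈-matchings⁺ n L (len , λ t t<m → nth-All bound t (subst (t <_) (sym len) t<m) , isMatchingB-sound m L ok t t<m) , odd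
  matching⇒word : ∀ {L} → L ∈ matchings n → (oddBlocksL m L ≡ᵇ k) ≡ true →
    L ∈ words m m × (isMatchingB m L ∧ (oddBlocksL m L ≡ᵇ k)) ≡ true
  matching⇒word {L} L∈ odd = let (len , match) = ∈-matchings⁻ n L∈ in
    ∈-words⁺ m m len (All-nth L (λ t t< → proj₁ (match t (subst (t <_) len t<)))) ,
    ∧-intro (isMatchingB-complete m L (λ t t<m → proj₂ (match t t<m))) odd

oddFlag : (ℕ → ℕ) → ℕ → ℕ
oddFlag F t = ind ((t <ᵇ F t) ∧ (t % 2 ≡ᵇ 0))

oddBlocksL-sum : ∀ m L → oddBlocksL m L ≡ sumTo m (oddFlag (nth L))
oddBlocksL-sum m L = count-upTo (λ t → (t <ᵇ nth L t) ∧ (t % 2 ≡ᵇ 0)) m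

oddBlocksL-applyUpTo : ∀ m F → oddBlocksL (suc (suc m)) (applyUpTo F (suc (suc m))) ≡
  oddFlag F 0 + (oddFlag F 1 + sumTo m (λ t → oddFlag F (suc (suc t))))
oddBlocksL-applyUpTo m F =
  trans (oddBlocksL-sum (suc (suc m)) (applyUpTo F (suc (suc m))))
  (trans (sumTo-cong (suc (suc m)) (λ t t< → cong (λ v → ind ((t <ᵇ v) ∧ (t % 2 ≡ᵇ 0))) (nth-applyUpTo (suc (suc m)) F t t<)))
  (trans (sumTo-head (suc m) (oddFlag F)) (cong (oddFlag F 0 +_) (sumTo-head m (oddFlag F ∘ suc)))))

-- The block {0, 1} is odd, and shifting by 2 preserves parities.
odd-pairFirstTwo : ∀ m M → oddBlocksL (suc (suc m)) (applyUpTo (pairFirstTwo M) (suc (suc m))) ≡ suc (oddBlocksL m M)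
odd-pairFirstTwo m M = trans (oddBlocksL-applyUpTo m (pairFirstTwo M)) (cong suc (sym (oddBlocksL-sum m M)))

-- Opening the block {a, c} of M into {0, a + 2} (odd) and {1, c + 2}
-- (even) loses the flags of a and c.
module OpenBlock (m : ℕ) (M : List ℕ) (matchM : Matching m M) (a : ℕ) (a<m : a < m) where
  flag = oddFlag (nth M)
  c = nth M a
  c≢a : ¬ (c ≡ a)
  c≢a = proj₂ (proj₂ (proj₂ matchM a a<m))
  F = pairVia M a

  F-a : F (suc (suc a)) ≡ 0
  F-a rewrite ≡ᵇ-refl a = refl
  F-c : F (suc (suc c)) ≡ 1
  F-c rewrite ≡ᵇ-false c a c≢a | ≡ᵇ-refl c = refl
  F-other : ∀ t → ¬ (t ≡ a) → ¬ (t ≡ c) → F (suc (suc t)) ≡ suc (suc (nth M t))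
  F-other t t≢a t≢c rewrite ≡ᵇ-false t a t≢a | ≡ᵇ-false t c t≢c = refl

  flag-F : ∀ t v → F (suc (suc t)) ≡ v → oddFlag F (suc (suc t)) ≡ ind ((suc (suc t) <ᵇ v) ∧ (t % 2 ≡ᵇ 0))
  flag-F t v e = cong (λ u → ind ((suc (suc t) <ᵇ u) ∧ (t % 2 ≡ᵇ 0))) e

  pointwise : ∀ t → oddFlag F (suc (suc t)) + (δ a t * flag a + δ c t * flag c) ≡ flag t
  pointwise t with t ≟ a
  ... | yes refl = trans (cong₂ (λ u v → u + (v * flag t + δ c t * flag c)) (flag-F t 0 F-a) (δ-eq {t} refl))
                   (trans (cong (λ v → 0 + (1 * flag t + v * flag c)) (δ-neq c≢a)) (only-first (flag t) (flag c)))
    where only-first : ∀ x y → 0 + (1 * x + 0 * y) ≡ x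
          only-first = solve-∀
  ... | no t≢a with t ≟ c
  ...   | yes refl = trans (cong₂ (λ u v → u + (v * flag a + δ t t * flag t)) (flag-F t 1 F-c) (δ-neq (t≢a ∘ sym)))
                     (trans (cong (λ v → 0 + (0 * flag a + v * flag t)) (δ-eq {t} refl)) (only-second (flag a) (flag t)))
    where only-second : ∀ x y → 0 + (0 * x + 1 * y) ≡ y
          only-second = solve-∀
  ...   | no t≢c = trans (cong₂ _+_ (flag-F t (suc (suc (nth M t))) (F-other t t≢a t≢c))
                                    (cong₂ (λ p q → p * flag a + q * flag c) (δ-neq (t≢a ∘ sym)) (δ-neq (t≢c ∘ sym))))
                         (neither (flag t) (flag a) (flag c))
    where neither : ∀ z x y → z + (0 * x + 0 * y) ≡ z
          neither = solve-∀

  deltas : sumTo m (λ t → δ a t * flag a + δ c t * flag c) ≡ flag a + flag c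
  deltas = trans (sumTo-+ m (λ t → δ a t * flag a) (λ t → δ c t * flag c))
    (cong₂ _+_ (trans (sumTo-*ʳ m (flag a) (δ a)) (trans (cong (flag a *_) (sumTo-δ m a a<m)) (*-identityʳ (flag a))))
               (trans (sumTo-*ʳ m (flag c) (δ c)) (trans (cong (flag c *_) (sumTo-δ m c (proj₁ (proj₂ matchM a a<m)))) (*-identityʳ (flag c)))))

  odd-pairVia : oddBlocksL (suc (suc m)) (applyUpTo F (suc (suc m))) + (flag a + flag c) ≡ suc (oddBlocksL m M)
  odd-pairVia =
    trans (cong (_+ (flag a + flag c)) (oddBlocksL-applyUpTo m F))
    (cong suc (trans shifted (sym (oddBlocksL-sum m M))))
    where
    shifted : sumTo m (λ t → oddFlag F (suc (suc t))) + (flag a + flag c) ≡ sumTo m flag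
    shifted = trans (cong (sumTo m (λ t → oddFlag F (suc (suc t))) +_) (sym deltas))
      (trans (sym (sumTo-+ m (λ t → oddFlag F (suc (suc t))) (λ t → δ a t * flag a + δ c t * flag c))) (sumTo-cong m (λ t _ → pointwise t)))

block-flags≤1 : ∀ x y (p q : Bool) → ind ((x <ᵇ y) ∧ p) + ind ((y <ᵇ x) ∧ q) ≤ 1
block-flags≤1 x y p q with x <ᵇ y in x<y | y <ᵇ x in y<x
... | true | true = ⊥-elim (<-asym (<ᵇ-sound x y x<y) (<ᵇ-sound y x y<x))
... | false | r = ind≤1 (r ∧ q)
... | true | false = ≤-trans (≤-reflexive (+-identityʳ (ind p))) (ind≤1 p)

module ExtensionCount (m : ℕ) (M : List ℕ) (matchM : Matching m M) where
  g = nth M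
  flag = oddFlag g
  o = oddBlocksL m M

  blockFlag : ℕ → ℕ
  blockFlag a = flag a + flag (g a)

  blockFlag≤1 : ∀ a → a < m → blockFlag a ≤ 1
  blockFlag≤1 a a<m = subst (λ z → flag a + ind ((g a <ᵇ z) ∧ (g a % 2 ≡ᵇ 0)) ≤ 1) (sym (proj₁ (proj₂ (proj₂ matchM a a<m)))) (block-flags≤1 a (g a) _ _)

  -- The partner map is a bijection of [0, m), so it does not change flag sums.
  flag-partner-sum : sumTo m (flag ∘ g) ≡ sumTo m flag
  flag-partner-sum = trans (sym (count-upTo (test ∘ g) m)) (trans (≤-antisym (count-≤ _ _ g _ _ u into g-inj) (count-≤ _ _ g _ _ u onto g-inj)) (count-upTo test m))
    where
    test : ℕ → Bool
    test t = (t <ᵇ g t) ∧ (t % 2 ≡ᵇ 0)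
    u = Unique.upTo⁺ m
    g< : ∀ {x} → x ∈ upTo m → g x < m
    g< x∈ = proj₁ (proj₂ matchM _ (∈-upTo⁻ x∈))
    gg : ∀ {x} → x ∈ upTo m → g (g x) ≡ x
    gg x∈ = proj₁ (proj₂ (proj₂ matchM _ (∈-upTo⁻ x∈)))
    g-inj : ∀ {x y} {P Q : Set} → x ∈ upTo m → y ∈ upTo m → P → Q → g x ≡ g y → x ≡ y
    g-inj x∈ y∈ _ _ e = trans (sym (gg x∈)) (trans (cong g e) (gg y∈))
    into : ∀ {x} → x ∈ upTo m → test (g x) ≡ true → g x ∈ upTo m × test (g x) ≡ true
    into x∈ t = ∈-upTo⁺ (g< x∈) , t
    onto : ∀ {x} → x ∈ upTo m → test x ≡ true → g x ∈ upTo m × test (g (g x)) ≡ true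
    onto {x} x∈ t = ∈-upTo⁺ (g< x∈) , subst (λ z → test z ≡ true) (sym (gg x∈)) t

  -- Each odd block is counted at both of its elements.
  blockFlag-sum : sumTo m blockFlag ≡ o + o
  blockFlag-sum = trans (sumTo-+ m flag (flag ∘ g)) (trans (cong (sumTo m flag +_) flag-partner-sum) (cong₂ _+_ (sym (oddBlocksL-sum m M)) (sym (oddBlocksL-sum m M))))

  2o≤m : o + o ≤ m
  2o≤m = subst (_≤ m) blockFlag-sum
    (≤-trans (m≤m+n (sumTo m blockFlag) _)
             (≤-reflexive (trans (sym (sumTo-+ m blockFlag (λ a → 1 ∸ blockFlag a)))
                                 (trans (sumTo-cong m (λ a a<m → m+[n∸m]≡n (blockFlag≤1 a a<m))) (sumTo-1 m)))))

  -- Of the m + 1 extensions, 2o keep o odd blocks and the others have o + 1.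
  extensions-by-odd-blocks : ∀ K → count (λ L → oddBlocksL (suc (suc m)) L ≡ᵇ K) (extensions m M) ≡
     ind (suc o ≡ᵇ K) + (ind (o ≡ᵇ K) * (o + o) + ind (suc o ≡ᵇ K) * (m ∸ (o + o)))
  extensions-by-odd-blocks K = cong₂ _+_ (cong (λ v → ind (v ≡ᵇ K)) (odd-pairFirstTwo m M)) (begin
    count test (map (λ a → applyUpTo (pairVia M a) (suc (suc m))) (upTo m))
      ≡⟨ trans (count-map test _ (upTo m)) (count-upTo _ m) ⟩
    sumTo m (λ a → ind (oddBlocksL (suc (suc m)) (applyUpTo (pairVia M a) (suc (suc m))) ≡ᵇ K))
      ≡⟨ sumTo-cong m (λ a a<m → ind-shift _ (blockFlag a) o K (OpenBlock.odd-pairVia m M matchM a a<m) (blockFlag≤1 a a<m)) ⟩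
    sumTo m (λ a → blockFlag a * A + (1 ∸ blockFlag a) * B)
      ≡⟨ trans (sumTo-+ m _ _) (cong₂ _+_ (sumTo-*ʳ m A blockFlag) (sumTo-*ʳ m B (λ a → 1 ∸ blockFlag a))) ⟩
    A * sumTo m blockFlag + B * sumTo m (λ a → 1 ∸ blockFlag a)
      ≡⟨ cong₂ (λ u v → A * u + B * v) blockFlag-sum
               (trans (sumTo-complement m blockFlag blockFlag≤1) (cong (m ∸_) blockFlag-sum)) ⟩
    A * (o + o) + B * (m ∸ (o + o)) ∎)
    where
    open ≡-Reasoning
    test : List ℕ → Bool
    test L = oddBlocksL (suc (suc m)) L ≡ᵇ K
    A = ind (o ≡ᵇ K)
    B = ind (suc o ≡ᵇ K)

-- Recurrence for N: each matching of [0, 2n + 2) extends exactly one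
-- matching of [0, 2n).
N-by-extension : ∀ n K → N (suc n) K ≡
  sumL (λ M → let o = oddBlocksL (double n) M in ind (suc o ≡ᵇ K) + (ind (o ≡ᵇ K) * (o + o) + ind (suc o ≡ᵇ K) * (double n ∸ (o + o)))) (matchings n)
N-by-extension n K =
  trans (N-matchings (suc n) K) (trans (count-concatMap (λ L → oddBlocksL (double (suc n)) L ≡ᵇ K) (extensions (double n)) (matchings n))
    (sumL-cong (matchings n) (λ {M} M∈ → ExtensionCount.extensions-by-odd-blocks (double n) M (∈-matchings⁻ n M∈) K)))

sum-matchings-odd : ∀ n K c → sumL (λ M → c * ind (oddBlocksL (double n) M ≡ᵇ K)) (matchings n) ≡ c * N n K
sum-matchings-odd n K c =
  trans (sumL-* c (λ M → ind (oddBlocksL (double n) M ≡ᵇ K)) (matchings n))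
        (cong (c *_) (sym (trans (N-matchings n K) (count-sumL (λ M → oddBlocksL (double n) M ≡ᵇ K) (matchings n)))))

-- The recurrences of the matching numbers; there is always an odd block.
N-rec₀ : ∀ n → N (suc n) 0 ≡ 0
N-rec₀ n = trans (N-by-extension n 0) (trans (sumL-cong (matchings n) (λ {M} _ → at-odd (oddBlocksL (double n) M))) (sumL-0 (matchings n)))
  where at-odd : ∀ o → ind (suc o ≡ᵇ 0) + (ind (o ≡ᵇ 0) * (o + o) + ind (suc o ≡ᵇ 0) * (double n ∸ (o + o))) ≡ 0
        at-odd zero = refl
        at-odd (suc o) = refl

N-rec : ∀ n k → N (suc n) (suc k) ≡ (2 * k + 2) * N n (suc k) + (2 * n + 1 ∸ 2 * k) * N n k
N-rec n k = begin
  N (suc n) (suc k)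
    ≡⟨ N-by-extension n (suc k) ⟩
  sumL (λ M → let o = oddBlocksL (double n) M in ind (o ≡ᵇ k) + (ind (o ≡ᵇ suc k) * (o + o) + ind (o ≡ᵇ k) * (double n ∸ (o + o)))) (matchings n)
    ≡⟨ sumL-cong (matchings n) (λ {M} M∈ → at-odd (oddBlocksL (double n) M) (ExtensionCount.2o≤m (double n) M (∈-matchings⁻ n M∈))) ⟩
  sumL (λ M → (2 * k + 2) * ind (oddBlocksL (double n) M ≡ᵇ suc k) + (2 * n + 1 ∸ 2 * k) * ind (oddBlocksL (double n) M ≡ᵇ k)) (matchings n)
    ≡⟨ sumL-+ _ _ (matchings n) ⟩
  _ ≡⟨ cong₂ _+_ (sum-matchings-odd n (suc k) (2 * k + 2)) (sum-matchings-odd n k (2 * n + 1 ∸ 2 * k)) ⟩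
  (2 * k + 2) * N n (suc k) + (2 * n + 1 ∸ 2 * k) * N n k ∎
  where
  open ≡-Reasoning
  at-odd : ∀ o → o + o ≤ double n → ind (o ≡ᵇ k) + (ind (o ≡ᵇ suc k) * (o + o) + ind (o ≡ᵇ k) * (double n ∸ (o + o))) ≡
                                    (2 * k + 2) * ind (o ≡ᵇ suc k) + (2 * n + 1 ∸ 2 * k) * ind (o ≡ᵇ k)
  at-odd o 2o≤ with o ≟ suc k
  ... | yes refl rewrite ≡ᵇ-refl k | ≡ᵇ-false (suc k) k (λ e → <-irrefl (sym e) ≤-refl) = simplify k (double n) (2 * n + 1 ∸ 2 * k)
    where simplify : ∀ k d c → 0 + (1 * (suc k + suc k) + 0 * d) ≡ (2 * k + 2) * 1 + c * 0
          simplify = solve-∀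
  ... | no o≢1+k with o ≟ k
  ...   | yes refl rewrite ≡ᵇ-refl o | ≡ᵇ-false o (suc o) o≢1+k =
    trans (cong suc (+-identityʳ (double n ∸ (o + o))))
    (trans (sym (+-∸-assoc 1 2o≤))
    (trans (cong₂ _∸_ (trans (cong suc (double≡2* n)) (+-comm 1 (2 * n))) (cong (o +_) (sym (+-identityʳ o))))
           (simplify (2 * o + 2) (2 * n + 1 ∸ 2 * o))))
    where simplify : ∀ a c → c ≡ a * 0 + c * 1
          simplify = solve-∀
  ...   | no o≢k rewrite ≡ᵇ-false o k o≢k | ≡ᵇ-false o (suc k) o≢1+k = simplify (o + o) (double n ∸ (o + o)) (2 * k + 2) (2 * n + 1 ∸ 2 * k)
    where simplify : ∀ a b c d → 0 + (0 * a + 0 * b) ≡ c * 0 + d * 0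
          simplify = solve-∀

2*suc : ∀ i → 2 * suc i ≡ suc (suc (2 * i))
2*suc = solve-∀

∸-suc-suc : ∀ a b → suc (suc b) ≤ a → a ∸ b ≡ suc (suc (a ∸ suc (suc b)))
∸-suc-suc (suc (suc a)) zero (s≤s (s≤s z≤n)) = refl
∸-suc-suc (suc a) (suc b) (s≤s b+2≤a) = ∸-suc-suc a b b+2≤a

drop-zeros : ∀ x c d → x + (c * 0 + d * 0) ≡ x
drop-zeros x c d rewrite *-zeroʳ c | *-zeroʳ d = +-identityʳ x

P-vanish : ∀ n K → 1 ≤ n → n ≤ 2 * K → P n K ≡ 0
P-vanish (suc zero) zero _ ()
P-vanish (suc zero) (suc K) _ _ = refl
P-vanish (suc (suc n)) zero _ ()
P-vanish (suc (suc n)) (suc K) _ n≤2K =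
  trans (P-rec (suc n) (s≤s z≤n) K)
    (cong₂ _+_ (trans (cong ((2 * K + 4) *_) (P-vanish (suc n) (suc K) (s≤s z≤n) (≤-trans (n≤1+n (suc n)) n≤2K))) (*-zeroʳ (2 * K + 4)))
               (cong (_* P (suc n) K) (m≤n⇒m∸n≡0 (≤-pred (≤-trans n≤2K (≤-reflexive (2*suc K)))))))

xzCoeff-diagonal : ∀ m i → xzCoeff (suc m) (suc (suc (2 * i))) (suc m) ≡ P (suc m) i
xzCoeff-diagonal zero zero = refl
xzCoeff-diagonal zero (suc i) = refl
xzCoeff-diagonal (suc m) zero = begin
  xzCoeff (suc (suc m)) 2 (suc (suc m))
    ≡⟨ xzCoeff-rec (suc m) 0 (suc m) ⟩
  2 * xzCoeff (suc m) 2 (suc m) + (c * xzCoeff (suc m) 0 (suc m) + d * xzCoeff (suc m) 0 (suc (suc (suc m))))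
    ≡⟨ cong₂ (λ u v → 2 * xzCoeff (suc m) 2 (suc m) + (c * u + d * v)) (xzCoeff-X⁰ m (suc m)) (xzCoeff-X⁰ m (suc (suc (suc m)))) ⟩
  2 * xzCoeff (suc m) 2 (suc m) + (c * 0 + d * 0)
    ≡⟨ drop-zeros (2 * xzCoeff (suc m) 2 (suc m)) c d ⟩
  2 * xzCoeff (suc m) 2 (suc m)
    ≡⟨ cong (2 *_) (xzCoeff-diagonal m zero) ⟩
  2 * P (suc m) 0
    ≡⟨ sym (P-rec₀ (suc m) (s≤s z≤n)) ⟩
  P (suc (suc m)) 0 ∎
  where open ≡-Reasoning
        c = 2 * suc m + 1 ∸ (0 + suc m)
        d = suc (suc (suc m))
xzCoeff-diagonal (suc m) (suc i) = begin
  xzCoeff (suc (suc m)) (suc (suc (2 * suc i))) (suc (suc m))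
    ≡⟨ cong (λ B → xzCoeff (suc (suc m)) (suc (suc B)) (suc (suc m))) (2*suc i) ⟩
  xzCoeff (suc (suc m)) (suc (suc A)) (suc (suc m))
    ≡⟨ xzCoeff-rec (suc m) A (suc m) ⟩
  suc (suc A) * xzCoeff (suc m) (suc (suc A)) (suc m) + (c * xzCoeff (suc m) A (suc m) + d * xzCoeff (suc m) A d)
    ≡⟨ cong (λ v → suc (suc A) * xzCoeff (suc m) (suc (suc A)) (suc m) + (c * xzCoeff (suc m) A (suc m) + d * v))
            (xzCoeff-Z>m m A d (s≤s (n≤1+n (suc m)))) ⟩
  suc (suc A) * xzCoeff (suc m) (suc (suc A)) (suc m) + (c * xzCoeff (suc m) A (suc m) + d * 0)
    ≡⟨ cong₂ (λ u v → suc (suc A) * u + (c * v + d * 0))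
             (trans (cong (λ B → xzCoeff (suc m) (suc (suc B)) (suc m)) (sym (2*suc i))) (xzCoeff-diagonal m (suc i)))
             (xzCoeff-diagonal m i) ⟩
  suc (suc A) * P (suc m) (suc i) + (c * P (suc m) i + d * 0)
    ≡⟨ cong (suc (suc A) * P (suc m) (suc i) +_) (trans (cong (c * P (suc m) i +_) (*-zeroʳ d)) (+-identityʳ _)) ⟩
  suc (suc A) * P (suc m) (suc i) + c * P (suc m) i
    ≡⟨ cong₂ (λ u v → u * P (suc m) (suc i) + v * P (suc m) i) (coefficient₁ i) coefficient₂ ⟩
  (2 * i + 4) * P (suc m) (suc i) + (suc m ∸ suc (2 * i)) * P (suc m) i
    ≡⟨ sym (P-rec (suc m) (s≤s z≤n) i) ⟩
  P (suc (suc m)) (suc i) ∎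
  where
  open ≡-Reasoning
  A = suc (suc (2 * i))
  c = 2 * suc m + 1 ∸ (A + suc m)
  d = suc (suc (suc m))
  coefficient₁ : ∀ i → suc (suc (suc (suc (2 * i)))) ≡ 2 * i + 4
  coefficient₁ = solve-∀
  coefficient₂ : c ≡ suc m ∸ suc (2 * i)
  coefficient₂ = trans (cong₂ _∸_ (split₁ m) (split₂ m i)) ([m+n]∸[m+o]≡n∸o (suc (suc m)) (suc m) (suc (2 * i)))
    where split₁ : ∀ m → 2 * suc m + 1 ≡ suc (suc m) + suc m
          split₁ = solve-∀
          split₂ : ∀ m i → suc (suc (2 * i)) + suc m ≡ suc (suc m) + suc (2 * i)
          split₂ = solve-∀

antidiagonal-first : ∀ m → 2 * xzCoeff (suc m) 2 (suc m) ≡ P (suc (suc m)) 0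
antidiagonal-first m = trans (cong (2 *_) (xzCoeff-diagonal m 0)) (sym (P-rec₀ (suc m) (s≤s z≤n)))

antidiagonal-interior : ∀ m i → 2 * suc i < suc (suc m) →
  2 * xzCoeff (suc m) (suc (suc (2 * suc i))) (suc m ∸ 2 * suc i) ≡ P (suc (suc m)) (suc i) →
  2 * xzCoeff (suc m) (suc (suc (2 * i))) (suc m ∸ 2 * i) ≡ P (suc (suc m)) i →
  2 * xzCoeff (suc (suc m)) (suc (suc (2 * suc i))) (suc (suc m) ∸ 2 * suc i) ≡ P (suc (suc (suc m))) (suc i)
antidiagonal-interior m i lt IH₁ IH₀ = begin
  2 * xzCoeff (suc (suc m)) A (suc (suc m) ∸ 2 * suc i)
    ≡⟨ cong (λ Z → 2 * xzCoeff (suc (suc m)) A Z) (+-∸-assoc 1 {suc m} {2 * suc i} (≤-pred lt)) ⟩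
  2 * xzCoeff (suc (suc m)) A (suc z₀)
    ≡⟨ cong (2 *_) (xzCoeff-rec (suc m) (2 * suc i) z₀) ⟩
  2 * (A * E + (c * xzCoeff (suc m) (2 * suc i) z₀ + suc (suc z₀) * xzCoeff (suc m) (2 * suc i) (suc (suc z₀))))
    ≡⟨ cong₂ (λ u v → 2 * (A * E + (c * u + suc (suc z₀) * v))) (xzCoeff-small m (2 * suc i) z₀ small) (cong₂ (xzCoeff (suc m)) (2*suc i) z₀+2) ⟩
  2 * (A * E + (c * 0 + suc (suc z₀) * T))
    ≡⟨ collect A E c (suc (suc z₀)) T ⟩
  A * (2 * E) + suc (suc z₀) * (2 * T)
    ≡⟨ cong₂ (λ u v → A * u + suc (suc z₀) * v) IH₁ IH₀ ⟩
  A * P (suc (suc m)) (suc i) + suc (suc z₀) * P (suc (suc m)) i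
    ≡⟨ cong₂ (λ u v → u * P (suc (suc m)) (suc i) + v * P (suc (suc m)) i) (coefficient i) z₀+2 ⟩
  (2 * i + 4) * P (suc (suc m)) (suc i) + (suc (suc m) ∸ suc (2 * i)) * P (suc (suc m)) i
    ≡⟨ sym (P-rec (suc (suc m)) (s≤s z≤n) i) ⟩
  P (suc (suc (suc m))) (suc i) ∎
  where
  open ≡-Reasoning
  A = suc (suc (2 * suc i))
  z₀ = suc m ∸ 2 * suc i
  E = xzCoeff (suc m) A z₀
  T = xzCoeff (suc m) (suc (suc (2 * i))) (suc m ∸ 2 * i)
  c = 2 * suc m + 1 ∸ (2 * suc i + z₀)
  z₀+2 : suc (suc z₀) ≡ suc m ∸ 2 * i
  z₀+2 = trans (cong (λ B → suc (suc (suc m ∸ B))) (2*suc i)) (sym (∸-suc-suc (suc m) (2 * i) (subst (_≤ suc m) (2*suc i) (≤-pred lt))))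
  small : 2 * suc i + z₀ ≤ suc (suc m)
  small = ≤-trans (≤-reflexive (m+[n∸m]≡n (≤-pred lt))) (n≤1+n (suc m))
  collect : ∀ A E c d T → 2 * (A * E + (c * 0 + d * T)) ≡ A * (2 * E) + d * (2 * T)
  collect A E c d T rewrite *-zeroʳ c = distribute A E d T
    where distribute : ∀ A E d T → 2 * (A * E + (0 + d * T)) ≡ A * (2 * E) + d * (2 * T)
          distribute = solve-∀
  coefficient : ∀ i → suc (suc (2 * suc i)) ≡ 2 * i + 4
  coefficient = solve-∀

antidiagonal-boundary : ∀ m i → 2 * suc i ≡ suc (suc m) →
  2 * xzCoeff (suc m) (suc (suc (2 * i))) (suc m ∸ 2 * i) ≡ P (suc (suc m)) i →
  2 * xzCoeff (suc (suc m)) (suc (suc (2 * suc i))) (suc (suc m) ∸ 2 * suc i) ≡ P (suc (suc (suc m))) (suc i)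
antidiagonal-boundary m i eq IH₀ = begin
  2 * xzCoeff (suc (suc m)) (suc (suc (2 * suc i))) (suc (suc m) ∸ 2 * suc i)
    ≡⟨ cong (λ Z → 2 * xzCoeff (suc (suc m)) (suc (suc (2 * suc i))) Z) (trans (cong (suc (suc m) ∸_) eq) (n∸n≡0 (suc (suc m)))) ⟩
  2 * xzCoeff (suc (suc m)) (suc (suc (2 * suc i))) 0
    ≡⟨ cong (2 *_) (xzCoeff-rec₀ (suc m) (2 * suc i)) ⟩
  2 * xzCoeff (suc m) (2 * suc i) 1
    ≡⟨ cong₂ (λ A Z → 2 * xzCoeff (suc m) A Z) (2*suc i) (sym one) ⟩
  2 * xzCoeff (suc m) (suc (suc (2 * i))) (suc m ∸ 2 * i)
    ≡⟨ IH₀ ⟩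
  P (suc (suc m)) i
    ≡⟨ sym (trans (cong₂ (λ u v → (2 * i + 4) * u + v * P (suc (suc m)) i) top-vanishes one)
                  (trans (cong (_+ 1 * P (suc (suc m)) i) (*-zeroʳ (2 * i + 4))) (+-identityʳ (P (suc (suc m)) i)))) ⟩
  (2 * i + 4) * P (suc (suc m)) (suc i) + (suc m ∸ 2 * i) * P (suc (suc m)) i
    ≡⟨ sym (P-rec (suc (suc m)) (s≤s z≤n) i) ⟩
  P (suc (suc (suc m))) (suc i) ∎
  where
  open ≡-Reasoning
  2i≡m : 2 * i ≡ m
  2i≡m = suc-injective (suc-injective (trans (sym (2*suc i)) eq))
  one : suc m ∸ 2 * i ≡ 1
  one = trans (cong (suc m ∸_) 2i≡m) (trans (+-∸-assoc 1 {m} {m} ≤-refl) (cong suc (n∸n≡0 m)))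
  top-vanishes : P (suc (suc m)) (suc i) ≡ 0
  top-vanishes = P-vanish (suc (suc m)) (suc i) (s≤s z≤n) (≤-reflexive (sym eq))

xzCoeff-antidiagonal : ∀ m i → 2 * i ≤ suc m → 2 * xzCoeff (suc m) (suc (suc (2 * i))) (suc m ∸ 2 * i) ≡ P (suc (suc m)) i
xzCoeff-antidiagonal m zero _ = antidiagonal-first m
xzCoeff-antidiagonal zero (suc i) 2i+2≤1 with ≤-trans (≤-reflexive (sym (2*suc i))) 2i+2≤1
... | s≤s ()
xzCoeff-antidiagonal (suc m) (suc i) 2i+2≤ with m≤n⇒m<n∨m≡n 2i+2≤
... | inj₁ lt = antidiagonal-interior m i lt (xzCoeff-antidiagonal m (suc i) (≤-pred lt))
                  (xzCoeff-antidiagonal m i (≤-trans (≤-trans (n≤1+n (2 * i)) (≤-trans (n≤1+n _) (≤-reflexive (sym (2*suc i))))) (≤-pred lt)))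
... | inj₂ eq = antidiagonal-boundary m i eq (xzCoeff-antidiagonal m i (≤-trans (≤-reflexive (suc-injective (suc-injective (trans (sym (2*suc i)) eq)))) (n≤1+n m)))

xCoeff-N : ∀ m K → xCoeff (suc m) (2 * K) ≡ N (suc m) K
xCoeff-N zero zero = refl
xCoeff-N zero (suc zero) = refl
xCoeff-N zero (suc (suc K)) = trans (cong (xCoeff 1) (trans (2*suc (suc K)) (cong (λ x → suc (suc x)) (2*suc K)))) refl
xCoeff-N (suc m) zero = trans (xCoeff-0 (suc m)) (sym (N-rec₀ (suc m)))
xCoeff-N (suc m) (suc K) = begin
  xCoeff (suc (suc m)) (2 * suc K)
    ≡⟨ cong (xCoeff (suc (suc m))) (2*suc K) ⟩
  xCoeff (suc (suc m)) (suc (suc (2 * K)))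
    ≡⟨ xCoeff-rec (suc m) (2 * K) ⟩
  suc (suc (2 * K)) * xCoeff (suc m) (suc (suc (2 * K))) + (2 * suc m + 1 ∸ 2 * K) * xCoeff (suc m) (2 * K)
    ≡⟨ cong₂ (λ u v → u + (2 * suc m + 1 ∸ 2 * K) * v)
             (cong₂ _*_ (+-comm 2 (2 * K)) (trans (cong (xCoeff (suc m)) (sym (2*suc K))) (xCoeff-N m (suc K)))) (xCoeff-N m K) ⟩
  (2 * K + 2) * N (suc m) (suc K) + (2 * suc m + 1 ∸ 2 * K) * N (suc m) K
    ≡⟨ sym (N-rec (suc m) K) ⟩
  N (suc (suc m)) (suc K) ∎
  where open ≡-Reasoning

half-decomposition : ∀ n → 2 * (n / 2) + n % 2 ≡ n
half-decomposition n = trans (+-comm (2 * (n / 2)) (n % 2)) (trans (cong (n % 2 +_) (*-comm 2 (n / 2))) (sym (m≡m%n+[m/n]*n n 2)))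

b-diagonal : ∀ n i → b n i (n / 2) ≡ xzCoeff n (suc (suc (2 * i))) n
b-diagonal n i = trans (b-xzCoeff n i (n / 2)) (cong₂ (xzCoeff n) (+-comm (2 * i) 2) (half-decomposition n))

2i≤n : ∀ n i → i ≤ n / 2 → 2 * i ≤ n
2i≤n n i i≤ = ≤-trans (*-monoʳ-≤ 2 i≤) (≤-trans (m≤m+n (2 * (n / 2)) (n % 2)) (≤-reflexive (half-decomposition n)))

b-antidiagonal : ∀ n i → i ≤ n / 2 → b n i (n / 2 ∸ i) ≡ xzCoeff n (suc (suc (2 * i))) (n ∸ 2 * i)
b-antidiagonal n i i≤ = trans (b-xzCoeff n i (n / 2 ∸ i)) (cong₂ (xzCoeff n) (+-comm (2 * i) 2) Z≡)
  where Z≡ : 2 * (n / 2 ∸ i) + n % 2 ≡ n ∸ 2 * i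
        Z≡ = trans (cong (_+ n % 2) (*-distribˡ-∸ 2 (n / 2) i))
                   (trans (sym (+-∸-comm (n % 2) (*-monoʳ-≤ 2 i≤))) (cong (_∸ 2 * i) (half-decomposition n)))

P-beyond-half : ∀ n i → n / 2 < i → P (suc n) i ≡ 0
P-beyond-half n i half<i = P-vanish (suc n) i (s≤s z≤n) (≤-trans (s≤s n≤) (≤-trans (≤-reflexive (lemma (n / 2))) (*-monoʳ-≤ 2 half<i)))
  where n≤ : n ≤ 2 * (n / 2) + 1
        n≤ = ≤-trans (≤-reflexive (sym (half-decomposition n))) (+-monoʳ-≤ (2 * (n / 2)) (≤-pred (m%n<n n 2)))
        lemma : ∀ q → suc (2 * q + 1) ≡ 2 * suc q
        lemma = solve-∀

theorem4p3 : (n : ℕ) → 1 ≤ n →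
    (sumTo (suc n) (λ i → sumTo (suc n) (λ j → b n i j)) ≡ oddDoubleFact n)
    × ((i : ℕ) → sumTo (suc n) (λ j → b n i j) ≡ N n (suc i))
    × ((i : ℕ) → b n i (n / 2) ≡ P n i)
    × ((i : ℕ) → i ≤ n / 2 → 2 * b n i (n / 2 ∸ i) ≡ P (suc n) i)
    × ((i : ℕ) → n / 2 < i → P (suc n) i ≡ 0)
theorem4p3 (suc m) _ = total , row , diagonal , antidiagonal , P-beyond-half (suc m)
  where
  n = suc m
  -- (i): the sum of all b n i j is the sum of all coefficients.
  total : sumTo (suc n) (λ i → sumTo (suc n) (λ j → b n i j)) ≡ oddDoubleFact n
  total = trans (sumTo-cong (suc n) (λ i _ → b-row-sum m i)) (trans (xCoeff-even-sum m) (coeffSum-oddDoubleFact n))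
  -- (ii): the row sums are X-coefficients, which count matchings.
  row : (i : ℕ) → sumTo (suc n) (λ j → b n i j) ≡ N n (suc i)
  row i = trans (b-row-sum m i) (trans (cong (xCoeff n) (sym (2*suc i))) (xCoeff-N m (suc i)))
  diagonal : (i : ℕ) → b n i (n / 2) ≡ P n i
  diagonal i = trans (b-diagonal n i) (xzCoeff-diagonal m i)
  antidiagonal : (i : ℕ) → i ≤ n / 2 → 2 * b n i (n / 2 ∸ i) ≡ P (suc n) i
  antidiagonal i i≤ = trans (cong (2 *_) (b-antidiagonal n i i≤)) (xzCoeff-antidiagonal m i (2i≤n n i i≤))
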